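{- Let $b\ge 2$ be an integer and let $k,r,y$ be nonnegative integers with $2y<r<k-1$. If $r$ is even, then $\nu(k,r,y)=\gamma(k,r,y)+1$ and $\mu(k,r,y)=V(k,r,y)$. If $k-2=r\equiv 3\pmod 4$ and $y\geq\frac{r+1}{4}$, then $\nu(k,r,y)=\gamma(k,r,(r-3)/4)+1$ and $\mu(k,r,y)=V(k,r,(r-3)/4)$. Otherwise, $\nu(k,r,y)=\gamma(k,r,\delta(r,y))+1$ and $\mu(k,r,y)=V(k,r,\delta(r,y))$, where $\delta(r,y)=\min\left\{\left\lceil\frac{r-1}{4}\right\rceil,y\right\}$.
   Context: Fix an integer $b\ge 2$. A base $b$ over-expansion of a positive integer $N$ is a word $d_kd_{k-1}\cdots d_0$ over $\{0,1,\ldots,b\}$ with $d_k\neq 0$ and $\sum_{i=0}^k d_ib^i=N$; the ordinary base $b$ expansion is the unique one using only digits $0,\dots,b-1$. For $n\ge 2$, $s_b(n)$ is the number of base $b$ over-expansions of $n-1$; $s_b(0)=0$, $s_b(1)=1$. For nonnegative integers $k,r,y$: $I(k,r,y)=\{n\in\mathbb N: b^k<n\le b^k+\sum_{i=0}^y b^{r-2i}\}$, $\mu(k,r,y)=\max\{s_b(n):n\in I(k,r,y)\}$, and $\nu(k,r,y)=\min\{n\in I(k,r,y): s_b(n)=\mu(k,r,y)\}$. For nonnegative integers $k,r,x$ with $2x<r<k-1$, $w(k,r,x)$ is the word $10^{k-r-1}(10)^x0(10)^{\lfloor r/2\rfloor-x}0$ if $r$ is odd and $10^{k-r-1}(10)^x0(10)^{\lfloor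 r/2\rfloor-x}$ if $r$ is even (exponents denote repetition), and $\gamma(k,r,x)$ is the positive integer whose ordinary base $b$ expansion is $w(k,r,x)$. For integers $k,r,x$, $V(k,r,x)=\frac15\big((k-r)(2L_{r+2}-L_{r-4x+1})+2L_{r+1}+L_{r-4x+2}\big)$, where $L_j$ are the Lucas numbers with $L_1=1$, $L_2=3$, $L_{j+2}=L_{j+1}+L_j$ for all integers $j$. -}

module Defs where

open import Data.Nat using (ℕ; zero; suc; _+_; _*_; _∸_; _^_; _≤_; _<_; _≟_; _⊔_; _⊓_; _/_; _%_)
open import Data.Integer as ℤ using (ℤ; +_)
open import Data.Rational as ℚ using (ℚ)
open import Data.List using (List; []; _∷_; _++_; map; concatMap; filter; length; upTo; foldr; foldl; replicate; concat)
open import Data.Product using (_×_; _,_; proj₁)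
open import Relation.Nullary using (Dec; yes; no; ¬_)
open import Relation.Nullary.Decidable using (_×-dec_; ¬?)

-- Words are lists of digits, most significant digit FIRST (d_k ... d_0).

value : ℕ → List ℕ → ℕ
value b = foldl (λ acc d → acc * b + d) 0

wordsOfLength : ℕ → ℕ → List (List ℕ)
wordsOfLength b zero = [] ∷ []
wordsOfLength b (suc m) = concatMap (λ d → map (d ∷_) (wordsOfLength b m)) (upTo (suc b))

LeadingNonzero : List ℕ → Set
LeadingNonzero [] = ¬ (0 ≡ 0) where open import Relation.Binary.PropositionalEquality using (_≡_)
LeadingNonzero (d ∷ _) = ¬ (d ≡ 0) where open import Relation.Binary.PropositionalEquality using (_≡_)

leadingNonzero? : (w : List ℕ) → Dec (LeadingNonzero w)
leadingNonzero? [] = no (λ f → f refl) where open import Relation.Binary.PropositionalEquality using (refl)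
leadingNonzero? (d ∷ _) = ¬? (d ≟ 0)

open import Relation.Binary.PropositionalEquality using (_≡_)

-- Any such word of N ≥ 1 has length ≤ N (since b^k ≤ N with b ≥ 2), so we
-- enumerate all words of lengths 0,…,N+1 (words of different lengths are distinct).
overExpansions : ℕ → ℕ → List (List ℕ)
overExpansions b N =
  filter (λ w → leadingNonzero? w ×-dec (value b w ≟ N))
         (concatMap (wordsOfLength b) (upTo (suc (suc N))))

s : ℕ → ℕ → ℕ
s b zero = 0
s b (suc zero) = 1
s b (suc (suc m)) = length (overExpansions b (suc m))   -- n = m+2, counts over-expansions of n-1

sumTo : ℕ → (ℕ → ℕ) → ℕ
sumTo zero f = f 0
sumTo (suc y) f = sumTo y f + f (suc y)

intervalLength : ℕ → ℕ → ℕ → ℕ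
intervalLength b r y = sumTo y (λ i → b ^ (r ∸ 2 * i))

-- the elements of I(k,r,y) = {n : b^k < n ≤ b^k + Σ ...}, in increasing order
interval : ℕ → ℕ → ℕ → ℕ → List ℕ
interval b k r y = map (λ j → b ^ k + suc j) (upTo (intervalLength b r y))

μ : ℕ → ℕ → ℕ → ℕ → ℕ
μ b k r y = foldr _⊔_ 0 (map (s b) (interval b k r y))

-- first element of a list satisfying s_b n = m (0 if none)
firstWith : ℕ → ℕ → List ℕ → ℕ
firstWith b m [] = 0
firstWith b m (n ∷ ns) with s b n ≟ m
... | yes _ = n
... | no _ = firstWith b m ns

ν : ℕ → ℕ → ℕ → ℕ → ℕ
ν b k r y = firstWith b (μ b k r y) (interval b k r y)

rep10 : ℕ → List ℕ
rep10 n = concat (replicate n (1 ∷ 0 ∷ []))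

w : ℕ → ℕ → ℕ → List ℕ
w k r x = 1 ∷ replicate (k ∸ r ∸ 1) 0 ++ rep10 x ++ 0 ∷ rep10 (r / 2 ∸ x) ++ tail
  where
    tail : List ℕ
    tail with r % 2
    ... | zero = []
    ... | suc _ = 0 ∷ []

γ : ℕ → ℕ → ℕ → ℕ → ℕ
γ b k r x = value b (w k r x)

-- Lucas numbers on all integers: L_0 = 2, L_1 = 1 (so L_2 = 3), L_{j+2} = L_{j+1} + L_j
-- lucasPos n = (L_n , L_{n+1});  lucasNeg n = (L_{-n} , L_{-n+1}) using L_j = L_{j+2} - L_{j+1}
lucasPos : ℕ → ℤ × ℤ
lucasPos zero = (+ 2 , + 1)
lucasPos (suc n) with lucasPos n
... | (a , c) = (c , a ℤ.+ c)

lucasNeg : ℕ → ℤ × ℤ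
lucasNeg zero = (+ 2 , + 1)
lucasNeg (suc n) with lucasNeg n
... | (a , c) = (c ℤ.- a , a)

L : ℤ → ℤ
L (+ n) = proj₁ (lucasPos n)
L (ℤ.-[1+ n ]) = proj₁ (lucasNeg (suc n))

V : ℤ → ℤ → ℤ → ℚ
V k r x = ((k ℤ.- r) ℤ.* (+ 2 ℤ.* L (r ℤ.+ + 2) ℤ.- L (r ℤ.- + 4 ℤ.* x ℤ.+ + 1))
           ℤ.+ + 2 ℤ.* L (r ℤ.+ + 1) ℤ.+ L (r ℤ.- + 4 ℤ.* x ℤ.+ + 2)) ℚ./ 5

-- δ(r,y) = min{⌈(r-1)/4⌉, y}   (for r ≥ 1, ⌈(r-1)/4⌉ = (r-1+3) div 4)
δ : ℕ → ℕ → ℕ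
δ r y = ((r ∸ 1 + 3) / 4) ⊓ y

module Submission where

-- Write n - 1 = bᵏ + j.  Sorting the over-expansions of n - 1 by their leading
-- digit shows s_b(n) = x · c(R) + y · c(bᵐ + R), where c counts the words of
-- length m with value R and the pair (x , y) evolves as the digits of j are
-- read from the top: 0 ↦ (x + y , y), 1 ↦ (x , x + y), d ≥ 2 ↦ (x , x).  On
-- I(k, r, y), after the leading 1 and the zeros behind it, the pair is
-- (k - r , 1).  Along m further digits the value is at most
-- F₍ₘ₊₁₎ · max + Fₘ · min, first attained on the alternating digits 1010…, so
-- the maximum over the branch of I(k, r, y) with prefix (10)ⁱ0 is a Fibonacci
-- expression that Lucas identities turn into V(k, r, i).  Consecutive branch
-- maxima differ by F_t - (k - r) F₍ₜ₋₁₎ with t = r - 4i, whose sign is read off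
-- from t; hence the branch maxima are unimodal in i, their peak is μ, and its
-- first attainment is ν.

module Automaton where

  open import Data.Nat
  open import Data.Nat.Properties
  open import Data.Product using (_×_; _,_)
  open import Data.Sum using (inj₁; inj₂)
  open import Relation.Nullary using (contradiction)
  open import Relation.Binary.PropositionalEquality
  open import Data.Nat.Tactic.RingSolver using (solve-∀)

  fib : ℕ → ℕ
  fib 0 = 0
  fib 1 = 1
  fib (suc (suc n)) = fib (suc n) + fib n

  fib-pos : ∀ n → 1 ≤ fib (suc n)
  fib-pos zero = s≤s z≤n
  fib-pos (suc n) = ≤-trans (fib-pos n) (m≤m+n _ _)

  fib-strict : ∀ n → n ≢ 1 → fib n < fib (suc n)
  fib-strict zero _ = s≤s z≤n
  fib-strict (suc zero) n≢1 = contradiction refl n≢1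
  fib-strict (suc (suc n)) _ = m<m+n (fib (suc (suc n))) (fib-pos n)

  -- A pair (x , y) stands for the linear form x · c(R) + y · c(bᵐ + R) in the
  -- counting function c; reading the leading digit of R transforms the pair.
  Coeffs : Set
  Coeffs = ℕ × ℕ

  read0 read1 read2 read10 : Coeffs → Coeffs
  read0 (x , y) = (x + y , y)
  read1 (x , y) = (x , x + y)
  read2 (x , y) = (x , x)
  read10 s = read0 (read1 s)

  readDigit : ℕ → Coeffs → Coeffs
  readDigit zero = read0
  readDigit (suc zero) = read1
  readDigit (suc (suc _)) = read2

  fibBound : ℕ → Coeffs → ℕ
  fibBound zero (x , y) = x
  fibBound (suc n) (x , y) = fib (2 + n) * (x ⊔ y) + fib (1 + n) * (x ⊓ y)

  ⊔+⊓≡+ : ∀ x y → x ⊔ y + x ⊓ y ≡ x + y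
  ⊔+⊓≡+ x y with ≤-total x y
  ... | inj₁ x≤y rewrite m≤n⇒m⊔n≡n x≤y | m≤n⇒m⊓n≡m x≤y = +-comm y x
  ... | inj₂ y≤x rewrite m≥n⇒m⊔n≡m y≤x | m≥n⇒m⊓n≡n y≤x = refl

  fibBound-≥ : ∀ n {x y} → y ≤ x → fibBound (suc n) (x , y) ≡ fib (2 + n) * x + fib (1 + n) * y
  fibBound-≥ n y≤x rewrite m≥n⇒m⊔n≡m y≤x | m≥n⇒m⊓n≡n y≤x = refl

  fibBound-≤ : ∀ n {x y} → x ≤ y → fibBound (suc n) (x , y) ≡ fib (2 + n) * y + fib (1 + n) * x
  fibBound-≤ n x≤y rewrite m≤n⇒m⊔n≡n x≤y | m≤n⇒m⊓n≡m x≤y = refl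

  fibBound-one : ∀ x y → fibBound 1 (x , y) ≡ x + y
  fibBound-one x y = trans (cong₂ _+_ (+-identityʳ (x ⊔ y)) (+-identityʳ (x ⊓ y))) (⊔+⊓≡+ x y)

  fibBound-read0 : ∀ n x y → fibBound (suc n) (read0 (x , y)) ≡ fib (2 + n) * (x + y) + fib (1 + n) * y
  fibBound-read0 n x y = fibBound-≥ n (m≤n+m y x)

  fibBound-read1 : ∀ n x y → fibBound (suc n) (read1 (x , y)) ≡ fib (2 + n) * (x + y) + fib (1 + n) * x
  fibBound-read1 n x y = fibBound-≤ n (m≤m+n x y)

  -- The Fibonacci recurrence moves the larger coordinate into the sum x + y.
  fibBound-suc : ∀ n x y → fibBound (2 + n) (x , y) ≡ fib (2 + n) * (x + y) + fib (1 + n) * (x ⊔ y)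
  fibBound-suc n x y = begin
    (p + q) * (x ⊔ y) + p * (x ⊓ y)  ≡⟨ regroup p q (x ⊔ y) (x ⊓ y) ⟩
    p * (x ⊔ y + x ⊓ y) + q * (x ⊔ y) ≡⟨ cong (λ t → p * t + q * (x ⊔ y)) (⊔+⊓≡+ x y) ⟩
    p * (x + y) + q * (x ⊔ y)        ∎
    where
    open ≡-Reasoning
    p q : ℕ
    p = fib (2 + n)
    q = fib (1 + n)
    regroup : ∀ p q M m → (p + q) * M + p * m ≡ p * (M + m) + q * M
    regroup = solve-∀

  fibBound-shrink : ∀ n {x y x′ y′} → x′ ⊔ y′ ≤ x + y → x′ ⊓ y′ ≤ x ⊔ y →
                    fibBound (suc n) (x′ , y′) ≤ fibBound (2 + n) (x , y)
  fibBound-shrink n {x} {y} {x′} {y′} max≤ min≤ = subst (fibBound (suc n) (x′ , y′) ≤_) (sym (fibBound-suc n x y))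
    (+-mono-≤ (*-monoʳ-≤ (fib (2 + n)) max≤) (*-monoʳ-≤ (fib (1 + n)) min≤))

  fibBound-readDigit : ∀ n d s → fibBound n (readDigit d s) ≤ fibBound (suc n) s
  fibBound-readDigit zero d (x , y) = subst (fibBound 0 (readDigit d (x , y)) ≤_) (sym (fibBound-one x y)) (first≤ d)
    where
    first≤ : ∀ d → fibBound 0 (readDigit d (x , y)) ≤ x + y
    first≤ zero = ≤-refl
    first≤ (suc zero) = m≤m+n x y
    first≤ (suc (suc _)) = m≤m+n x y
  fibBound-readDigit (suc n) zero (x , y) =
    fibBound-shrink n (⊔-lub ≤-refl (m≤n+m y x)) (≤-trans (m⊓n≤n (x + y) y) (m≤n⊔m x y))
  fibBound-readDigit (suc n) (suc zero) (x , y) =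
    fibBound-shrink n (⊔-lub (m≤m+n x y) ≤-refl) (≤-trans (m⊓n≤m x (x + y)) (m≤m⊔n x y))
  fibBound-readDigit (suc n) (suc (suc _)) (x , y) =
    fibBound-shrink n (⊔-lub (m≤m+n x y) (m≤m+n x y)) (≤-trans (m⊓n≤m x x) (m≤m⊔n x y))

  fibBound-via-read1 : ∀ n {x y} → y ≤ x → fibBound (2 + n) (x , y) ≡ fibBound (suc n) (read1 (x , y))
  fibBound-via-read1 n {x} {y} y≤x = begin
    fibBound (2 + n) (x , y)                         ≡⟨ fibBound-suc n x y ⟩
    fib (2 + n) * (x + y) + fib (1 + n) * (x ⊔ y)     ≡⟨ cong (λ t → fib (2 + n) * (x + y) + fib (1 + n) * t) (m≥n⇒m⊔n≡m y≤x) ⟩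
    fib (2 + n) * (x + y) + fib (1 + n) * x           ≡⟨ fibBound-read1 n x y ⟨
    fibBound (suc n) (read1 (x , y))                 ∎
    where open ≡-Reasoning

  fibBound-via-read0 : ∀ n {x y} → x ≤ y → fibBound (suc n) (x , y) ≡ fibBound n (read0 (x , y))
  fibBound-via-read0 zero {x} {y} _ = fibBound-one x y
  fibBound-via-read0 (suc n) {x} {y} x≤y = begin
    fibBound (2 + n) (x , y)                         ≡⟨ fibBound-suc n x y ⟩
    fib (2 + n) * (x + y) + fib (1 + n) * (x ⊔ y)     ≡⟨ cong (λ t → fib (2 + n) * (x + y) + fib (1 + n) * t) (m≤n⇒m⊔n≡n x≤y) ⟩
    fib (2 + n) * (x + y) + fib (1 + n) * y           ≡⟨ fibBound-read0 n x y ⟨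
    fibBound (suc n) (read0 (x , y))                 ∎
    where open ≡-Reasoning

  fibBound-read0<read1 : ∀ n {x y} → y < x → fibBound (suc n) (read0 (x , y)) < fibBound (suc n) (read1 (x , y))
  fibBound-read0<read1 n {x} {y} y<x = subst₂ _<_ (sym (fibBound-read0 n x y)) (sym (fibBound-read1 n x y))
    (+-monoʳ-< (fib (2 + n) * (x + y)) (*-monoʳ-< (fib (1 + n)) {{>-nonZero (fib-pos n)}} y<x))

  -- The bound for the inputs with leading digits (10)ⁱ0; V(k, r, i) = branchBound r (k - r , 1) i.
  branchBound : ℕ → Coeffs → ℕ → ℕ
  branchBound n s zero = fibBound n (read0 s)
  branchBound n s (suc i) = branchBound (n ∸ 2) (read10 s) i

  -- Consecutive branches differ by F₍ₘ₊₃₎ q - F₍ₘ₊₂₎ p, stated here without subtraction.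
  branchBound-step : ∀ m p q → branchBound (3 + m) (p , q) 0 + fib (2 + m) * p
                             ≡ branchBound (3 + m) (p , q) 1 + fib (3 + m) * q
  branchBound-step m p q = begin
    fibBound (3 + m) (read0 (p , q)) + fib (2 + m) * p
      ≡⟨ cong (_+ fib (2 + m) * p) (fibBound-read0 (2 + m) p q) ⟩
    fib (4 + m) * (p + q) + fib (3 + m) * q + fib (2 + m) * p
      ≡⟨ identity (fib (2 + m)) (fib (1 + m)) p q ⟩
    fib (2 + m) * (p + (p + q) + (p + q)) + fib (1 + m) * (p + q) + fib (3 + m) * q
      ≡⟨ cong (_+ fib (3 + m) * q) (fibBound-read0 m (p + (p + q)) (p + q)) ⟨
    fibBound (1 + m) (read0 (read10 (p , q))) + fib (3 + m) * q ∎
    where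
    open ≡-Reasoning
    identity : ∀ u v p q → (u + v + u) * (p + q) + (u + v) * q + u * p
                          ≡ u * (p + (p + q) + (p + q)) + v * (p + q) + (u + v) * q
    identity = solve-∀

module Maximum where

  open import Data.Nat
  open import Data.Nat.Properties
  open import Data.Nat.DivMod
  open import Data.Product using (∃; _×_; _,_; proj₁; proj₂)
  open import Data.Sum using (_⊎_; inj₁; inj₂)
  open import Data.Empty using (⊥-elim)
  open import Relation.Nullary using (yes; no)
  open import Relation.Binary.PropositionalEquality
  open Automaton

  split-at : ∀ N j → j < N ⊎ ∃ λ j′ → N + j′ ≡ j
  split-at N j with j <? N
  ... | yes j<N = inj₁ j<N
  ... | no j≮N = inj₂ (m≤n⇒∃[o]m+o≡n (≮⇒≥ j≮N))

  twice-suc≤ : ∀ {y n} → 2 * suc y ≤ n → ∃ λ m → n ≡ 2 + m × 2 * y ≤ m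
  twice-suc≤ {y} {n} p with subst (_≤ n) (*-suc 2 y) p
  ... | s≤s (s≤s q) = _ , refl , q

  twice-suc< : ∀ {y n} → 2 * suc y < n → ∃ λ m → n ≡ 2 + m × 2 * y < m
  twice-suc< {y} {n} p with subst (_< n) (*-suc 2 y) p
  ... | s≤s (s≤s q) = _ , refl , q

  -- Everything below only uses that ev is computed by reading the base b
  -- digits of its argument from the most significant one.
  module DigitRecursion (c : ℕ) (ev : ℕ → Coeffs → ℕ → ℕ)
    (ev-empty : ∀ s → ev 0 s 0 ≡ proj₁ s)
    (ev-digit : ∀ m s d R → d < 2 + c → R < (2 + c) ^ m →
                ev (suc m) s (d * (2 + c) ^ m + R) ≡ ev m (readDigit d s) R) where

    b : ℕ
    b = 2 + c

    b^n≤b^suc : ∀ n → b ^ n ≤ b ^ suc n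
    b^n≤b^suc n = m≤m+n (b ^ n) _

    b^n+b^n≤b^suc : ∀ n → b ^ n + b ^ n ≤ b ^ suc n
    b^n+b^n≤b^suc n = +-monoʳ-≤ (b ^ n) (m≤m+n (b ^ n) (c * b ^ n))

    ev-read0 : ∀ m s R → R < b ^ m → ev (suc m) s R ≡ ev m (read0 s) R
    ev-read0 m s R R< = ev-digit m s 0 R z<s R<

    ev-read1 : ∀ m s R → R < b ^ m → ev (suc m) s (b ^ m + R) ≡ ev m (read1 s) R
    ev-read1 m s R R< = trans (cong (λ t → ev (suc m) s (t + R)) (sym (*-identityˡ (b ^ m))))
                              (ev-digit m s 1 R (s≤s z<s) R<)

    ev-read10 : ∀ m s R → R < b ^ suc m → ev (3 + m) s (b ^ (2 + m) + R) ≡ ev (suc m) (read10 s) R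
    ev-read10 m s R R< = trans (ev-read1 (2 + m) s R (<-≤-trans R< (b^n≤b^suc (suc m))))
                               (ev-read0 (suc m) (read1 s) R R<)

    ev≤fibBound : ∀ n s j → j < b ^ n → ev n s j ≤ fibBound n s
    ev≤fibBound zero (x , y) zero _ = ≤-reflexive (ev-empty (x , y))
    ev≤fibBound zero _ (suc j) (s≤s ())
    ev≤fibBound (suc n) s j j< = begin
      ev (suc n) s j                ≡⟨ cong (ev (suc n) s) j≡ ⟩
      ev (suc n) s (d * b ^ n + R)  ≡⟨ ev-digit n s d R d<b R<b^n ⟩
      ev n (readDigit d s) R        ≤⟨ ev≤fibBound n (readDigit d s) R R<b^n ⟩
      fibBound n (readDigit d s)    ≤⟨ fibBound-readDigit n d s ⟩
      fibBound (suc n) s            ∎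
      where
      open ≤-Reasoning
      instance _ = m^n≢0 b n
      d R : ℕ
      d = j / b ^ n
      R = j % b ^ n
      j≡ : j ≡ d * b ^ n + R
      j≡ = trans (m≡m%n+[m/n]*n j (b ^ n)) (+-comm R (d * b ^ n))
      d<b : d < b
      d<b = m<n*o⇒m/o<n j<
      R<b^n : R < b ^ n
      R<b^n = m%n<n j (b ^ n)

    ev≤branchBound₀ : ∀ n s j → j < b ^ n → ev (suc n) s j ≤ branchBound n s 0
    ev≤branchBound₀ n s j j< = subst (_≤ _) (sym (ev-read0 n s j j<)) (ev≤fibBound n (read0 s) j j<)

    -- descPeak n has the n base b digits (10)^⌊n/2⌋ 0^(n mod 2).
    descPeak : ℕ → ℕ
    descPeak 0 = 0
    descPeak 1 = 0
    descPeak (suc (suc n)) = b ^ suc n + descPeak n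

    ascPeak : ℕ → ℕ
    ascPeak 0 = 0
    ascPeak (suc n) = descPeak n

    descPeak< : ∀ n → descPeak n < b ^ n
    descPeak< 0 = z<s
    descPeak< 1 = m^n>0 b 1
    descPeak< (suc (suc n)) = <-≤-trans
      (+-monoʳ-< (b ^ suc n) (<-≤-trans (descPeak< n) (b^n≤b^suc n))) (b^n+b^n≤b^suc (suc n))

    AttainsFirst : ℕ → Coeffs → ℕ → ℕ → Set
    AttainsFirst n s M o = ev n s o ≡ M × (∀ j → j < o → ev n s j < M)

    attainsFirst-via-read1 : ∀ n {x y} → y < x →
      AttainsFirst (suc n) (read1 (x , y)) (fibBound (suc n) (read1 (x , y))) (descPeak n) →
      AttainsFirst (2 + n) (x , y) (fibBound (2 + n) (x , y)) (descPeak (2 + n))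
    attainsFirst-via-read1 n {x} {y} y<x (at , before) = at′ , before′
      where
      open ≤-Reasoning
      u< : descPeak n < b ^ suc n
      u< = <-≤-trans (descPeak< n) (b^n≤b^suc n)
      peak≡ : fibBound (2 + n) (x , y) ≡ fibBound (suc n) (read1 (x , y))
      peak≡ = fibBound-via-read1 n (<⇒≤ y<x)
      at′ : ev (2 + n) (x , y) (descPeak (2 + n)) ≡ fibBound (2 + n) (x , y)
      at′ = trans (ev-read1 (suc n) (x , y) (descPeak n) u<) (trans at (sym peak≡))
      before′ : ∀ j → j < descPeak (2 + n) → ev (2 + n) (x , y) j < fibBound (2 + n) (x , y)
      before′ j j< with split-at (b ^ suc n) j
      ... | inj₁ j<b = begin-strict
        ev (2 + n) (x , y) j               ≤⟨ ev≤branchBound₀ (suc n) (x , y) j j<b ⟩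
        fibBound (suc n) (read0 (x , y))   <⟨ fibBound-read0<read1 n y<x ⟩
        fibBound (suc n) (read1 (x , y))   ≡⟨ peak≡ ⟨
        fibBound (2 + n) (x , y)           ∎
      ... | inj₂ (j′ , refl) = begin-strict
        ev (2 + n) (x , y) (b ^ suc n + j′) ≡⟨ ev-read1 (suc n) (x , y) j′ (<-trans j′<u u<) ⟩
        ev (suc n) (read1 (x , y)) j′       <⟨ before j′ j′<u ⟩
        fibBound (suc n) (read1 (x , y))    ≡⟨ peak≡ ⟨
        fibBound (2 + n) (x , y)            ∎
        where
        j′<u : j′ < descPeak n
        j′<u = +-cancelˡ-< (b ^ suc n) j′ (descPeak n) j<

    attainsFirst-via-read0 : ∀ n {x y} → x < y →
      AttainsFirst n (read0 (x , y)) (fibBound n (read0 (x , y))) (descPeak n) →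
      AttainsFirst (suc n) (x , y) (fibBound (suc n) (x , y)) (ascPeak (suc n))
    attainsFirst-via-read0 n {x} {y} x<y (at , before) = at′ , before′
      where
      peak≡ : fibBound (suc n) (x , y) ≡ fibBound n (read0 (x , y))
      peak≡ = fibBound-via-read0 n (<⇒≤ x<y)
      at′ : ev (suc n) (x , y) (descPeak n) ≡ fibBound (suc n) (x , y)
      at′ = trans (ev-read0 n (x , y) (descPeak n) (descPeak< n)) (trans at (sym peak≡))
      before′ : ∀ j → j < descPeak n → ev (suc n) (x , y) j < fibBound (suc n) (x , y)
      before′ j j< = subst₂ _<_ (sym (ev-read0 n (x , y) j (<-trans j< (descPeak< n)))) (sym peak≡)
                                (before j j<)

    attainsFirst-desc : ∀ n {x y} → y < x → 1 ≤ y → AttainsFirst n (x , y) (fibBound n (x , y)) (descPeak n)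
    attainsFirst-asc : ∀ n {x y} → x < y → 1 ≤ x → AttainsFirst n (x , y) (fibBound n (x , y)) (ascPeak n)

    attainsFirst-desc zero _ _ = ev-empty _ , λ _ ()
    attainsFirst-desc (suc zero) {x} {y} _ _ =
      trans (ev-read0 0 (x , y) 0 z<s) (trans (ev-empty (x + y , y)) (sym (fibBound-one x y))) , λ _ ()
    attainsFirst-desc (suc (suc n)) {x} {y} y<x 1≤y = attainsFirst-via-read1 n y<x
      (attainsFirst-asc (suc n) (m<m+n x 1≤y) (≤-trans 1≤y (<⇒≤ y<x)))
    attainsFirst-asc zero _ _ = ev-empty _ , λ _ ()
    attainsFirst-asc (suc n) {x} {y} x<y 1≤x = attainsFirst-via-read0 n x<y
      (attainsFirst-desc n (m<n+m y 1≤x) (≤-trans 1≤x (<⇒≤ x<y)))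

    span : ℕ → ℕ → ℕ
    span n zero = b ^ n
    span n (suc y) = b ^ n + span (n ∸ 2) y

    peakAt : ℕ → ℕ → ℕ
    peakAt n zero = descPeak n
    peakAt n (suc x) = b ^ n + peakAt (n ∸ 2) x

    b^n≤span : ∀ n y → b ^ n ≤ span n y
    b^n≤span n zero = ≤-refl
    b^n≤span n (suc y) = m≤m+n (b ^ n) _

    shift-<double : ∀ m {u} → u < b ^ m + b ^ m → b ^ (2 + m) + u < b ^ (2 + m) + b ^ (2 + m)
    shift-<double m u< = +-monoʳ-< (b ^ (2 + m)) (<-≤-trans u< (≤-trans (b^n+b^n≤b^suc m) (b^n≤b^suc (suc m))))

    span< : ∀ n y → 2 * y ≤ n → span n y < b ^ n + b ^ n
    span< n zero _ = m<m+n (b ^ n) (m^n>0 b n)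
    span< n (suc y) p with twice-suc≤ p
    ... | m , refl , q = shift-<double m (span< m y q)

    peakAt< : ∀ n x → 2 * x ≤ n → peakAt n x < b ^ n + b ^ n
    peakAt< n zero _ = <-≤-trans (descPeak< n) (m≤m+n (b ^ n) (b ^ n))
    peakAt< n (suc x) p with twice-suc≤ p
    ... | m , refl , q = shift-<double m (peakAt< m x q)

    peakAt<span : ∀ n {x y} → x ≤ y → 2 * y ≤ n → peakAt n x < span n y
    peakAt<span n {zero} {y} _ _ = <-≤-trans (descPeak< n) (b^n≤span n y)
    peakAt<span n {suc x} {suc y} (s≤s x≤y) p with twice-suc≤ p
    ... | m , refl , q = +-monoʳ-< (b ^ (2 + m)) (peakAt<span m x≤y q)

    ev≤-on-span : ∀ y n s {M} → 2 * y < n → (∀ i → i ≤ y → branchBound n s i ≤ M) →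
                  ∀ j → j < span n y → ev (suc n) s j ≤ M
    ev≤-on-span y n s _ bounded j j< with split-at (b ^ n) j
    ... | inj₁ j<b = ≤-trans (ev≤branchBound₀ n s j j<b) (bounded 0 z≤n)
    ev≤-on-span zero n s _ _ _ j< | inj₂ (j′ , refl) = ⊥-elim (m+n≮m (b ^ n) j′ j<)
    ev≤-on-span (suc y) n s y<n bounded _ j< | inj₂ (j′ , refl) with twice-suc< y<n
    ... | m , refl , q = subst (_≤ _) (sym (ev-read10 m s j′ j′<b))
        (ev≤-on-span y m (read10 s) q (λ i i≤y → bounded (suc i) (s≤s i≤y)) j′ j′<span)
      where
      j′<span : j′ < span m y
      j′<span = +-cancelˡ-< (b ^ (2 + m)) j′ (span m y) j<
      j′<b : j′ < b ^ suc m
      j′<b = <-≤-trans (<-trans j′<span (span< m y (<⇒≤ q))) (b^n+b^n≤b^suc m)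

    attainsFirst-peakAt : ∀ x n {p q} → 1 ≤ p → 1 ≤ q → 2 * x < n →
      (∀ i → i < x → branchBound n (p , q) i < branchBound n (p , q) x) →
      AttainsFirst (suc n) (p , q) (branchBound n (p , q) x) (peakAt n x)
    attainsFirst-peakAt zero n {p} {q} 1≤p 1≤q _ _ = at′ , before′
      where
      desc : AttainsFirst n (p + q , q) (branchBound n (p , q) 0) (descPeak n)
      desc = attainsFirst-desc n (m<n+m q 1≤p) 1≤q
      at′ : ev (suc n) (p , q) (descPeak n) ≡ branchBound n (p , q) 0
      at′ = trans (ev-read0 n (p , q) (descPeak n) (descPeak< n)) (proj₁ desc)
      before′ : ∀ j → j < descPeak n → ev (suc n) (p , q) j < branchBound n (p , q) 0
      before′ j j< = subst (_< _) (sym (ev-read0 n (p , q) j (<-trans j< (descPeak< n)))) (proj₂ desc j j<)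
    attainsFirst-peakAt (suc x) n {p} {q} 1≤p 1≤q x<n increasing with twice-suc< x<n
    ... | m , refl , x<m = at′ , before′
      where
      s = (p , q)
      M = branchBound m (read10 s) x
      IH : AttainsFirst (suc m) (read10 s) M (peakAt m x)
      IH = attainsFirst-peakAt x m (≤-trans 1≤p (m≤m+n p _)) (≤-trans 1≤p (m≤m+n p q)) x<m
                               (λ i i<x → increasing (suc i) (s≤s i<x))
      J<b : peakAt m x < b ^ suc m
      J<b = <-≤-trans (peakAt< m x (<⇒≤ x<m)) (b^n+b^n≤b^suc m)
      at′ : ev (3 + m) s (b ^ (2 + m) + peakAt m x) ≡ M
      at′ = trans (ev-read10 m s (peakAt m x) J<b) (proj₁ IH)
      before′ : ∀ j → j < b ^ (2 + m) + peakAt m x → ev (3 + m) s j < M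
      before′ j j< with split-at (b ^ (2 + m)) j
      ... | inj₁ j<b = ≤-<-trans (ev≤branchBound₀ (2 + m) s j j<b) (increasing 0 z<s)
      ... | inj₂ (j′ , refl) = subst (_< M) (sym (ev-read10 m s j′ (<-trans j′<J J<b))) (proj₂ IH j′ j′<J)
        where
        j′<J : j′ < peakAt m x
        j′<J = +-cancelˡ-< (b ^ (2 + m)) j′ (peakAt m x) j<

module Lucas where

  open import Data.Nat as ℕ using (ℕ; zero; suc; s≤s)
  import Data.Nat.Properties as ℕ
  open import Data.Integer using (ℤ; +_; -[1+_]; 0ℤ; _+_; _-_; _*_; -_)
  open import Data.Integer.Properties
  open import Data.Product using (_×_; _,_; proj₁; proj₂)
  open import Relation.Binary.PropositionalEquality
  open import Data.Integer.Tactic.RingSolver using (solve-∀)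
  open import Defs using (L; lucasPos; lucasNeg)
  open Automaton using (fib; Coeffs; read10; branchBound; fibBound-read0; branchBound-step)
  open Maximum using (twice-suc<)

  sign : ℕ → ℤ
  sign zero = + 1
  sign (suc n) = - sign n

  fibℤ : ℤ → ℤ
  fibℤ (+ n) = + fib n
  fibℤ -[1+ n ] = sign n * + fib (suc n)

  -- A record rather than a function type, so that u can be recovered by unification.
  record FibLike (u : ℤ → ℤ) : Set where
    constructor fibLike
    field recurrence : ∀ t → u (t + + 2) ≡ u (t + + 1) + u t

  fibLike-fibℤ : FibLike fibℤ
  fibLike-fibℤ = fibLike step
    where
    step : ∀ t → fibℤ (t + + 2) ≡ fibℤ (t + + 1) + fibℤ t
    step (+ n) rewrite ℕ.+-comm n 2 | ℕ.+-comm n 1 = refl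
    step -[1+ zero ] = refl
    step -[1+ suc zero ] = refl
    step -[1+ suc (suc n) ] = identity (sign n) (+ fib (suc n)) (+ fib (suc (suc n)))
      where
      identity : ∀ σ f₁ f₂ → σ * f₁ ≡ (- σ) * f₂ + (- (- σ)) * (f₂ + f₁)
      identity = solve-∀

  lucasPos-suc : ∀ n → lucasPos (suc n) ≡ (proj₂ (lucasPos n) , proj₁ (lucasPos n) + proj₂ (lucasPos n))
  lucasPos-suc n with lucasPos n
  ... | _ = refl

  lucasNeg-suc : ∀ n → lucasNeg (suc n) ≡ (proj₂ (lucasNeg n) - proj₁ (lucasNeg n) , proj₁ (lucasNeg n))
  lucasNeg-suc n with lucasNeg n
  ... | _ = refl

  fibLike-L : FibLike L
  fibLike-L = fibLike step
    where
    step : ∀ t → L (t + + 2) ≡ L (t + + 1) + L t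
    step (+ n) rewrite ℕ.+-comm n 2 | ℕ.+-comm n 1 | lucasPos-suc (suc n) | lucasPos-suc n =
      +-comm (proj₁ (lucasPos n)) (proj₂ (lucasPos n))
    step -[1+ zero ] = refl
    step -[1+ suc zero ] = refl
    step -[1+ suc (suc n) ] rewrite lucasNeg-suc (suc (suc (suc n))) | lucasNeg-suc (suc (suc n)) | lucasNeg-suc (suc n) =
      identity (proj₁ (lucasNeg n)) (proj₂ (lucasNeg n))
      where
      identity : ∀ x y → y - x ≡ (x - (y - x)) + ((y - x) - (x - (y - x)))
      identity = solve-∀

  fibLike-shift : ∀ {u} c → FibLike u → FibLike (λ t → u (t + c))
  fibLike-shift {u} c (fibLike rec) = fibLike λ t → begin
    u (t + + 2 + c)          ≡⟨ cong u (swap t (+ 2) c) ⟩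
    u (t + c + + 2)          ≡⟨ rec (t + c) ⟩
    u (t + c + + 1) + u (t + c) ≡⟨ cong (λ s → u s + u (t + c)) (swap t (+ 1) c) ⟨
    u (t + + 1 + c) + u (t + c) ∎
    where
    open ≡-Reasoning
    swap : ∀ t d c → t + d + c ≡ t + c + d
    swap = solve-∀

  fibLike-+ : ∀ {u v} → FibLike u → FibLike v → FibLike (λ t → u t + v t)
  fibLike-+ {u} {v} (fibLike ru) (fibLike rv) = fibLike λ t →
    trans (cong₂ _+_ (ru t) (rv t)) (regroup (u (t + + 1)) (u t) (v (t + + 1)) (v t))
    where
    regroup : ∀ a b c d → a + b + (c + d) ≡ a + c + (b + d)
    regroup = solve-∀

  fibLike-- : ∀ {u v} → FibLike u → FibLike v → FibLike (λ t → u t - v t)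
  fibLike-- {u} {v} (fibLike ru) (fibLike rv) = fibLike λ t →
    trans (cong₂ _-_ (ru t) (rv t)) (regroup (u (t + + 1)) (u t) (v (t + + 1)) (v t))
    where
    regroup : ∀ a b c d → a + b - (c + d) ≡ a - c + (b - d)
    regroup = solve-∀

  fibLike-*ˡ : ∀ {u} c → FibLike u → FibLike (λ t → c * u t)
  fibLike-*ˡ {u} c (fibLike rec) = fibLike λ t → trans (cong (c *_) (rec t)) (*-distribˡ-+ c (u (t + + 1)) (u t))

  fibLike-*ʳ : ∀ {u} c → FibLike u → FibLike (λ t → u t * c)
  fibLike-*ʳ {u} c (fibLike rec) = fibLike λ t → trans (cong (_* c) (rec t)) (*-distribʳ-+ c (u (t + + 1)) (u t))

  fibLike-zero : ∀ {d} → FibLike d → d 0ℤ ≡ 0ℤ → d (+ 1) ≡ 0ℤ → ∀ t → d t ≡ 0ℤ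
  fibLike-zero {d} (fibLike rec) d₀ d₁ = everywhere
    where
    summand-zero : ∀ {a b c} → a ≡ b + c → a ≡ 0ℤ → b ≡ 0ℤ → c ≡ 0ℤ
    summand-zero {a} {b} {c} eq a≡0 b≡0 =
      trans (sym (+-identityˡ c)) (trans (cong (_+ c) (sym b≡0)) (trans (sym eq) a≡0))
    upward : ∀ n → d (+ n) ≡ 0ℤ × d (+ suc n) ≡ 0ℤ
    upward zero = d₀ , d₁
    upward (suc n) with upward n
    ... | dn , dn+1 = dn+1 , (begin
      d (+ (2 ℕ.+ n))           ≡⟨ cong (λ m → d (+ m)) (ℕ.+-comm 2 n) ⟩
      d (+ n + + 2)             ≡⟨ rec (+ n) ⟩
      d (+ n + + 1) + d (+ n)   ≡⟨ cong₂ _+_ (trans (cong (λ m → d (+ m)) (ℕ.+-comm n 1)) dn+1) dn ⟩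
      0ℤ                        ∎)
      where open ≡-Reasoning
    downward : ∀ n → d -[1+ n ] ≡ 0ℤ × d (-[1+ n ] + + 1) ≡ 0ℤ
    downward zero = summand-zero (rec -[1+ 0 ]) d₁ d₀ , d₀
    downward (suc zero) = summand-zero (rec -[1+ 1 ]) d₀ (proj₁ (downward zero)) , proj₁ (downward zero)
    downward (suc (suc n)) with downward (suc n)
    ... | dn , dn+1 = summand-zero (rec -[1+ suc (suc n) ]) dn+1 dn , dn
    everywhere : ∀ t → d t ≡ 0ℤ
    everywhere (+ n) = proj₁ (upward n)
    everywhere -[1+ n ] = proj₁ (downward n)

  fibLike-unique : ∀ u v → FibLike u → FibLike v → u 0ℤ ≡ v 0ℤ → u (+ 1) ≡ v (+ 1) → ∀ t → u t ≡ v t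
  fibLike-unique u v ru rv e₀ e₁ t =
    i-j≡0⇒i≡j (u t) (v t) (fibLike-zero (fibLike-- ru rv) (difference e₀) (difference e₁) t)
    where
    difference : ∀ {a b} → a ≡ b → a - b ≡ 0ℤ
    difference {a} refl = +-inverseʳ a

  -- Both sides of each identity below are Fibonacci-like in t, so they agree
  -- once they agree at t = 0 and t = 1, where both reduce to numerals.
  lucas-shift4 : ∀ t → L (t - + 2) ≡ L (t + + 2) - + 5 * fibℤ t
  lucas-shift4 = fibLike-unique (λ t → L (t - + 2)) (λ t → L (t + + 2) - + 5 * fibℤ t) (fibLike-shift (- + 2) fibLike-L)
    (fibLike-- (fibLike-shift (+ 2) fibLike-L) (fibLike-*ˡ (+ 5) fibLike-fibℤ)) refl refl

  lucas-2L-L : ∀ t → + 2 * L (t + + 2) - L (t + + 1) ≡ + 5 * fibℤ (t + + 1)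
  lucas-2L-L = fibLike-unique (λ t → + 2 * L (t + + 2) - L (t + + 1)) (λ t → + 5 * fibℤ (t + + 1))
    (fibLike-- (fibLike-*ˡ (+ 2) (fibLike-shift (+ 2) fibLike-L)) (fibLike-shift (+ 1) fibLike-L))
    (fibLike-*ˡ (+ 5) (fibLike-shift (+ 1) fibLike-fibℤ)) refl refl

  lucas-2L+L : ∀ t → + 2 * L (t + + 1) + L (t + + 2) ≡ + 5 * fibℤ (t + + 2)
  lucas-2L+L = fibLike-unique (λ t → + 2 * L (t + + 1) + L (t + + 2)) (λ t → + 5 * fibℤ (t + + 2))
    (fibLike-+ (fibLike-*ˡ (+ 2) (fibLike-shift (+ 1) fibLike-L)) (fibLike-shift (+ 2) fibLike-L))
    (fibLike-*ˡ (+ 5) (fibLike-shift (+ 2) fibLike-fibℤ)) refl refl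

  fibForm : Coeffs → ℤ → ℤ
  fibForm (p , q) t = fibℤ t * + q - fibℤ (t - + 1) * + p

  fibLike-fibForm : ∀ s → FibLike (fibForm s)
  fibLike-fibForm (p , q) = fibLike-- (fibLike-*ʳ (+ q) fibLike-fibℤ) (fibLike-*ʳ (+ p) (fibLike-shift (- + 1) fibLike-fibℤ))

  fibForm-read10 : ∀ s t → fibForm (read10 s) t ≡ fibForm s (t - + 2)
  fibForm-read10 (p , q) = fibLike-unique (fibForm (read10 (p , q))) (λ t → fibForm (p , q) (t - + 2))
    (fibLike-fibForm (read10 (p , q))) (fibLike-shift (- + 2) (fibLike-fibForm (p , q)))
    (at0 (+ p) (+ q)) (at1 (+ p) (+ q))
    where
    at0 : ∀ p q → + 0 * (p + q) - + 1 * (p + (p + q)) ≡ - + 1 * q - + 2 * p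
    at0 = solve-∀
    at1 : ∀ p q → + 1 * (p + q) - + 0 * (p + (p + q)) ≡ + 1 * q - - + 1 * p
    at1 = solve-∀

  diff-of-+≡+ : ∀ {X Y c d} → X ℕ.+ c ≡ Y ℕ.+ d → + X - + Y ≡ + d - + c
  diff-of-+≡+ {X} {Y} {c} {d} eq = begin
    + X - + Y                  ≡⟨ add-both (+ X) (+ Y) (+ c) ⟩
    + (X ℕ.+ c) - (+ Y + + c)  ≡⟨ cong (λ z → + z - (+ Y + + c)) eq ⟩
    + Y + + d - (+ Y + + c)    ≡⟨ cancel (+ Y) (+ c) (+ d) ⟩
    + d - + c                  ∎
    where
    open ≡-Reasoning
    add-both : ∀ x y c → x - y ≡ (x + c) - (y + c)
    add-both = solve-∀
    cancel : ∀ y c d → (y + d) - (y + c) ≡ d - c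
    cancel = solve-∀

  branchBound-diff : ∀ i n s → 2 ℕ.* suc i ℕ.< n →
    + branchBound n s i - + branchBound n s (suc i) ≡ fibForm s (+ n - + 4 * + i)
  branchBound-diff zero (suc (suc (suc m))) (p , q) _ = begin
    + branchBound (3 ℕ.+ m) (p , q) 0 - + branchBound (3 ℕ.+ m) (p , q) 1
      ≡⟨ diff-of-+≡+ {c = fib (2 ℕ.+ m) ℕ.* p} {d = fib (3 ℕ.+ m) ℕ.* q} (branchBound-step m p q) ⟩
    + (fib (3 ℕ.+ m) ℕ.* q) - + (fib (2 ℕ.+ m) ℕ.* p)
      ≡⟨ cong₂ _-_ (pos-* (fib (3 ℕ.+ m)) q) (pos-* (fib (2 ℕ.+ m)) p) ⟩
    fibForm (p , q) (+ (3 ℕ.+ m))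
      ≡⟨ cong (λ z → fibForm (p , q) (+ z)) (ℕ.+-identityʳ (3 ℕ.+ m)) ⟨
    fibForm (p , q) (+ (3 ℕ.+ m) - + 4 * + 0) ∎
    where open ≡-Reasoning
  branchBound-diff zero 1 _ (s≤s ())
  branchBound-diff zero 2 _ (s≤s (s≤s ()))
  branchBound-diff (suc i) n s 2i+2<n with twice-suc< {suc i} 2i+2<n
  ... | m , refl , 2i<m = begin
    + branchBound m (read10 s) i - + branchBound m (read10 s) (suc i) ≡⟨ branchBound-diff i m (read10 s) 2i<m ⟩
    fibForm (read10 s) (+ m - + 4 * + i)                            ≡⟨ fibForm-read10 s (+ m - + 4 * + i) ⟩
    fibForm s (+ m - + 4 * + i - + 2)                               ≡⟨ cong (fibForm s) (reindex (+ m) (+ i)) ⟩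
    fibForm s (+ (2 ℕ.+ m) - + 4 * + suc i)                         ∎
    where
    open ≡-Reasoning
    reindex : ∀ m i → m - + 4 * i - + 2 ≡ (+ 2 + m) - + 4 * (+ 1 + i)
    reindex = solve-∀

  -- V k r x is numerator k r x / 5 by definition.
  numerator : ℤ → ℤ → ℤ → ℤ
  numerator k r x = (k - r) * (+ 2 * L (r + + 2) - L (r - + 4 * x + + 1)) + + 2 * L (r + + 1) + L (r - + 4 * x + + 2)

  numerator-step : ∀ k r x → let t = r - + 4 * x in
    numerator k r (x + + 1) ≡ numerator k r x - + 5 * (fibℤ t - (k - r) * fibℤ (t - + 1))
  numerator-step k r x = begin
    A * (+ 2 * L (r + + 2) - L (r - + 4 * (x + + 1) + + 1)) + + 2 * L (r + + 1) + L (r - + 4 * (x + + 1) + + 2)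
      ≡⟨ cong₂ (λ u v → A * (+ 2 * L (r + + 2) - L u) + + 2 * L (r + + 1) + L v) (index₁ r x) (index₂ r x) ⟩
    A * (+ 2 * L (r + + 2) - L (t - + 1 - + 2)) + + 2 * L (r + + 1) + L (t - + 2)
      ≡⟨ cong₂ (λ u v → A * (+ 2 * L (r + + 2) - u) + + 2 * L (r + + 1) + v) (lucas-shift4 (t - + 1)) (lucas-shift4 t) ⟩
    A * (+ 2 * L (r + + 2) - (L (t - + 1 + + 2) - + 5 * fibℤ (t - + 1))) + + 2 * L (r + + 1) + (L (t + + 2) - + 5 * fibℤ t)
      ≡⟨ cong (λ u → A * (+ 2 * L (r + + 2) - (L u - + 5 * fibℤ (t - + 1))) + + 2 * L (r + + 1) + (L (t + + 2) - + 5 * fibℤ t))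
              (index₃ t) ⟩
    A * (+ 2 * L (r + + 2) - (L (t + + 1) - + 5 * fibℤ (t - + 1))) + + 2 * L (r + + 1) + (L (t + + 2) - + 5 * fibℤ t)
      ≡⟨ regroup A (L (r + + 2)) (L (t + + 1)) (fibℤ (t - + 1)) (L (r + + 1)) (L (t + + 2)) (fibℤ t) ⟩
    numerator k r x - + 5 * (fibℤ t - A * fibℤ (t - + 1)) ∎
    where
    open ≡-Reasoning
    A t : ℤ
    A = k - r
    t = r - + 4 * x
    index₁ : ∀ r x → r - + 4 * (x + + 1) + + 1 ≡ r - + 4 * x - + 1 - + 2
    index₁ = solve-∀
    index₂ : ∀ r x → r - + 4 * (x + + 1) + + 2 ≡ r - + 4 * x - + 2
    index₂ = solve-∀
    index₃ : ∀ t → t - + 1 + + 2 ≡ t + + 1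
    index₃ = solve-∀
    regroup : ∀ A L₂ L₁′ F₁ L₁ L₂′ F₀ →
      A * (+ 2 * L₂ - (L₁′ - + 5 * F₁)) + + 2 * L₁ + (L₂′ - + 5 * F₀)
        ≡ A * (+ 2 * L₂ - L₁′) + + 2 * L₁ + L₂′ - + 5 * (F₀ - A * F₁)
    regroup = solve-∀

  numerator-base : ∀ k r → numerator k r 0ℤ ≡ + 5 * ((k - r) * fibℤ (r + + 1) + fibℤ (r + + 2))
  numerator-base k r = begin
    A * (+ 2 * L (r + + 2) - L (r - + 4 * 0ℤ + + 1)) + + 2 * L (r + + 1) + L (r - + 4 * 0ℤ + + 2)
      ≡⟨ cong₂ (λ u v → A * (+ 2 * L (r + + 2) - L u) + + 2 * L (r + + 1) + L v) (index r (+ 1)) (index r (+ 2)) ⟩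
    A * (+ 2 * L (r + + 2) - L (r + + 1)) + + 2 * L (r + + 1) + L (r + + 2)
      ≡⟨ regroup A (L (r + + 2)) (L (r + + 1)) ⟩
    A * (+ 2 * L (r + + 2) - L (r + + 1)) + (+ 2 * L (r + + 1) + L (r + + 2))
      ≡⟨ cong₂ (λ u v → A * u + v) (lucas-2L-L r) (lucas-2L+L r) ⟩
    A * (+ 5 * fibℤ (r + + 1)) + + 5 * fibℤ (r + + 2)
      ≡⟨ factor A (fibℤ (r + + 1)) (fibℤ (r + + 2)) ⟩
    + 5 * (A * fibℤ (r + + 1) + fibℤ (r + + 2)) ∎
    where
    open ≡-Reasoning
    A : ℤ
    A = k - r
    index : ∀ r c → r - + 4 * 0ℤ + c ≡ r + c
    index = solve-∀
    regroup : ∀ A x y → A * (+ 2 * x - y) + + 2 * y + x ≡ A * (+ 2 * x - y) + (+ 2 * y + x)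
    regroup = solve-∀
    factor : ∀ A f g → A * (+ 5 * f) + + 5 * g ≡ + 5 * (A * f + g)
    factor = solve-∀

  numerator≡5*branchBound : ∀ a k r i → + k - + r ≡ + a → 2 ℕ.* i ℕ.< r →
    numerator (+ k) (+ r) (+ i) ≡ + 5 * + branchBound r (a , 1) i
  numerator≡5*branchBound a k (suc r) zero k-r≡a _ = begin
    numerator (+ k) (+ suc r) 0ℤ
      ≡⟨ numerator-base (+ k) (+ suc r) ⟩
    + 5 * ((+ k - + suc r) * fibℤ (+ suc r + + 1) + fibℤ (+ suc r + + 2))
      ≡⟨ cong₂ (λ u v → + 5 * ((+ k - + suc r) * + fib u + + fib v)) (ℕ.+-comm (suc r) 1) (ℕ.+-comm (suc r) 2) ⟩
    + 5 * ((+ k - + suc r) * + fib (2 ℕ.+ r) + + fib (3 ℕ.+ r))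
      ≡⟨ cong (λ A → + 5 * (A * + fib (2 ℕ.+ r) + + fib (3 ℕ.+ r))) k-r≡a ⟩
    + 5 * (+ a * + fib (2 ℕ.+ r) + (+ fib (2 ℕ.+ r) + + fib (1 ℕ.+ r)))
      ≡⟨ cong (+ 5 *_) (regroup (+ a) (+ fib (2 ℕ.+ r)) (+ fib (1 ℕ.+ r))) ⟩
    + 5 * (+ fib (2 ℕ.+ r) * + (a ℕ.+ 1) + + fib (1 ℕ.+ r) * + 1)
      ≡⟨ cong (+ 5 *_) (cong₂ _+_ (pos-* (fib (2 ℕ.+ r)) (a ℕ.+ 1)) (pos-* (fib (1 ℕ.+ r)) 1)) ⟨
    + 5 * + (fib (2 ℕ.+ r) ℕ.* (a ℕ.+ 1) ℕ.+ fib (1 ℕ.+ r) ℕ.* 1)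
      ≡⟨ cong (λ z → + 5 * + z) (fibBound-read0 r a 1) ⟨
    + 5 * + branchBound (suc r) (a , 1) 0 ∎
    where
    open ≡-Reasoning
    regroup : ∀ a f₂ f₁ → a * f₂ + (f₂ + f₁) ≡ f₂ * (a + + 1) + f₁ * + 1
    regroup = solve-∀
  numerator≡5*branchBound a k r (suc i) k-r≡a 2i+2<r = begin
    numerator (+ k) (+ r) (+ suc i)
      ≡⟨ cong (numerator (+ k) (+ r)) (cong +_ (ℕ.+-comm 1 i)) ⟩
    numerator (+ k) (+ r) (+ i + + 1)
      ≡⟨ numerator-step (+ k) (+ r) (+ i) ⟩
    numerator (+ k) (+ r) (+ i) - + 5 * (fibℤ t - (+ k - + r) * fibℤ (t - + 1))
      ≡⟨ cong₂ (λ u v → u - + 5 * v)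
               (numerator≡5*branchBound a k r i k-r≡a (ℕ.<-trans (ℕ.*-monoʳ-< 2 (ℕ.n<1+n i)) 2i+2<r))
               (trans (cong (λ A → fibℤ t - A * fibℤ (t - + 1)) k-r≡a) (as-fibForm (fibℤ t) (fibℤ (t - + 1)) (+ a))) ⟩
    + 5 * + branchBound r (a , 1) i - + 5 * fibForm (a , 1) t
      ≡⟨ cong (λ v → + 5 * + branchBound r (a , 1) i - + 5 * v) (branchBound-diff i r (a , 1) 2i+2<r) ⟨
    + 5 * + branchBound r (a , 1) i - + 5 * (+ branchBound r (a , 1) i - + branchBound r (a , 1) (suc i))
      ≡⟨ cancel (+ branchBound r (a , 1) i) (+ branchBound r (a , 1) (suc i)) ⟩
    + 5 * + branchBound r (a , 1) (suc i) ∎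
    where
    open ≡-Reasoning
    t : ℤ
    t = + r - + 4 * + i
    as-fibForm : ∀ f g a → f - a * g ≡ f * + 1 - g * a
    as-fibForm = solve-∀
    cancel : ∀ x y → + 5 * x - + 5 * (x - y) ≡ + 5 * y
    cancel = solve-∀

module Unimodality where

  open import Data.Nat as ℕ using (ℕ; zero; suc; s≤s; z≤n)
  import Data.Nat.Properties as ℕ
  open import Data.Integer using (+_; -[1+_]; 0ℤ; _+_; _-_; _*_; -_; _<_; _≤_; +<+; +≤+; -<+)
  open import Data.Integer.Properties
  open import Data.Product using (∃; _×_; _,_)
  open import Data.Sum using (_⊎_; inj₁; inj₂)
  open import Relation.Binary.PropositionalEquality
  open import Relation.Nullary using (contradiction)
  import Data.Integer.Tactic.RingSolver as ℤ-Solver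
  import Data.Nat.Tactic.RingSolver as ℕ-Solver
  open Automaton using (fib; fib-pos; fib-strict; branchBound)
  open Lucas

  <⇒diff<0 : ∀ {i j} → i < j → i - j < 0ℤ
  <⇒diff<0 {i} {j} i<j = subst (i - j <_) (+-inverseʳ j) (+-monoˡ-< (- j) i<j)

  i-j+j≡i : ∀ i j → i - j + j ≡ i
  i-j+j≡i = ℤ-Solver.solve-∀

  diff<0⇒< : ∀ {i j} → i - j < 0ℤ → i < j
  diff<0⇒< {i} {j} i-j<0 = subst₂ _<_ (i-j+j≡i i j) (+-identityˡ j) (+-monoˡ-< j i-j<0)

  0<diff⇒> : ∀ {i j} → 0ℤ < i - j → j < i
  0<diff⇒> {i} {j} 0<i-j = subst₂ _<_ (+-identityˡ j) (i-j+j≡i i j) (+-monoˡ-< j 0<i-j)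

  unimodal-peak : ∀ (G : ℕ → ℕ) x y →
    (∀ i → i ℕ.< x → G i ℕ.< G (suc i)) → (∀ i → x ℕ.≤ i → i ℕ.< y → G (suc i) ℕ.≤ G i) →
    (∀ i → i ℕ.< x → G i ℕ.< G x) × (∀ i → i ℕ.≤ y → G i ℕ.≤ G x)
  unimodal-peak G x y ascending descending = (λ i i<x → rising i<x ℕ.≤-refl) , below-peak
    where
    rising : ∀ {i j} → i ℕ.< j → j ℕ.≤ x → G i ℕ.< G j
    rising {i} {suc j} (s≤s i≤j) j<x with ℕ.m≤n⇒m<n∨m≡n i≤j
    ... | inj₁ i<j = ℕ.<-trans (rising i<j (ℕ.<⇒≤ j<x)) (ascending j j<x)
    ... | inj₂ refl = ascending i j<x
    falling : ∀ j → x ℕ.≤ j → j ℕ.≤ y → G j ℕ.≤ G x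
    falling j x≤j j≤y with ℕ.m≤n⇒m<n∨m≡n x≤j
    ... | inj₂ refl = ℕ.≤-refl
    falling (suc j) _ j<y | inj₁ (s≤s x≤j) = ℕ.≤-trans (descending j x≤j j<y) (falling j x≤j (ℕ.<⇒≤ j<y))
    below-peak : ∀ i → i ℕ.≤ y → G i ℕ.≤ G x
    below-peak i i≤y with ℕ.<-≤-connex i x
    ... | inj₁ i<x = ℕ.<⇒≤ (rising i<x ℕ.≤-refl)
    ... | inj₂ x≤i = falling i x≤i i≤y

  sign-even : ∀ j → sign (2 ℕ.* j) ≡ + 1
  sign-odd : ∀ j → sign (suc (2 ℕ.* j)) ≡ - + 1
  sign-even zero = refl
  sign-even (suc j) = trans (cong sign (ℕ.*-suc 2 j)) (cong -_ (sign-odd j))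
  sign-odd j = cong -_ (sign-even j)

  index-below : ∀ {r q ρ} i d → r ≡ 4 ℕ.* q ℕ.+ ρ → q ≡ i ℕ.+ d → + r - + 4 * + i ≡ + (4 ℕ.* d ℕ.+ ρ)
  index-below {ρ = ρ} i d refl refl = begin
    + (4 ℕ.* (i ℕ.+ d)) + + ρ - + 4 * + i ≡⟨ cong (λ z → z + + ρ - + 4 * + i) (pos-* 4 (i ℕ.+ d)) ⟩
    + 4 * (+ i + + d) + + ρ - + 4 * + i   ≡⟨ cancel (+ i) (+ d) (+ ρ) ⟩
    + 4 * + d + + ρ                       ≡⟨ cong (_+ + ρ) (pos-* 4 d) ⟨
    + (4 ℕ.* d ℕ.+ ρ)                     ∎
    where
    open ≡-Reasoning
    cancel : ∀ i d ρ → + 4 * (i + d) + ρ - + 4 * i ≡ + 4 * d + ρ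
    cancel = ℤ-Solver.solve-∀

  index-beyond : ∀ {r} i m → 4 ℕ.* i ≡ r ℕ.+ suc m → + r - + 4 * + i ≡ -[1+ m ]
  index-beyond {r} i m 4i≡r+m+1 = begin
    + r - + 4 * + i       ≡⟨ cong (λ z → + r - z) (trans (sym (pos-* 4 i)) (cong +_ 4i≡r+m+1)) ⟩
    + r - (+ r + + suc m) ≡⟨ cancel (+ r) (+ suc m) ⟩
    - + suc m             ∎
    where
    open ≡-Reasoning
    cancel : ∀ r n → r - (r + n) ≡ - n
    cancel = ℤ-Solver.solve-∀

  index-above : ∀ {r q ρ} e m → r ≡ 4 ℕ.* q ℕ.+ ρ → ρ ℕ.+ suc m ≡ 4 ℕ.* suc e →
                + r - + 4 * + (q ℕ.+ suc e) ≡ -[1+ m ]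
  index-above {q = q} {ρ} e m refl eq = index-beyond (q ℕ.+ suc e) m (begin
    4 ℕ.* (q ℕ.+ suc e)         ≡⟨ ℕ.*-distribˡ-+ 4 q (suc e) ⟩
    4 ℕ.* q ℕ.+ 4 ℕ.* suc e     ≡⟨ cong (4 ℕ.* q ℕ.+_) eq ⟨
    4 ℕ.* q ℕ.+ (ρ ℕ.+ suc m)   ≡⟨ ℕ.+-assoc (4 ℕ.* q) ρ (suc m) ⟨
    4 ℕ.* q ℕ.+ ρ ℕ.+ suc m     ∎)
    where open ≡-Reasoning

  offset-view : ∀ q i → (∃ λ d → q ≡ i ℕ.+ d) ⊎ (∃ λ e → i ≡ q ℕ.+ suc e)
  offset-view q i with ℕ.≤-<-connex i q
  ... | inj₁ i≤q = inj₁ (q ℕ.∸ i , sym (ℕ.m+[n∸m]≡n i≤q))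
  ... | inj₂ q<i = inj₂ (i ℕ.∸ suc q , trans (sym (ℕ.m+[n∸m]≡n q<i)) (sym (ℕ.+-suc q (i ℕ.∸ suc q))))

  -- a = 2 + a′ is the difference k - r of the theorem.  fibForm (a , 1) t is
  -- negative for t = 0, 2, t ≥ 4 and even t < 0, positive for t = 1 and odd
  -- t < 0, and equals 2 - a at t = 3.
  module Signs (a′ : ℕ) where

    a : ℕ
    a = 2 ℕ.+ a′

    fib<a*fib : ∀ n → n ≢ 1 → fib (2 ℕ.+ n) ℕ.< a ℕ.* fib (1 ℕ.+ n)
    fib<a*fib n n≢1 = ℕ.<-≤-trans (ℕ.+-monoʳ-< (fib (1 ℕ.+ n)) (fib-strict n n≢1))
                                  (ℕ.+-monoʳ-≤ (fib (1 ℕ.+ n)) (ℕ.m≤m+n (fib (1 ℕ.+ n)) _))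

    fibForm-at-2+ : ∀ n → fib (2 ℕ.+ n) ℕ.< a ℕ.* fib (1 ℕ.+ n) → fibForm (a , 1) (+ (2 ℕ.+ n)) < 0ℤ
    fibForm-at-2+ n lt = subst (_< 0ℤ) (sym value) (<⇒diff<0 (+<+ lt))
      where
      as-difference : ∀ f g a → f * + 1 - g * a ≡ f - a * g
      as-difference = ℤ-Solver.solve-∀
      value : fibForm (a , 1) (+ (2 ℕ.+ n)) ≡ + fib (2 ℕ.+ n) - + (a ℕ.* fib (1 ℕ.+ n))
      value = trans (as-difference (+ fib (2 ℕ.+ n)) (+ fib (1 ℕ.+ n)) (+ a))
                    (cong (λ z → + fib (2 ℕ.+ n) - z) (sym (pos-* a (fib (1 ℕ.+ n)))))

    fibForm-at-0 : fibForm (a , 1) 0ℤ < 0ℤ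
    fibForm-at-0 = -<+

    fibForm-at-1 : 0ℤ < fibForm (a , 1) (+ 1)
    fibForm-at-1 = +<+ (s≤s z≤n)

    fibForm-at-3 : a′ ≡ 0 → 0ℤ ≤ fibForm (a , 1) (+ 3)
    fibForm-at-3 refl = +≤+ z≤n

    fibForm-at-neg : ∀ n → fibForm (a , 1) -[1+ n ] ≡ sign n * + (fib (1 ℕ.+ n) ℕ.+ a ℕ.* fib (2 ℕ.+ n))
    fibForm-at-neg n = begin
      sign n * + fib (1 ℕ.+ n) * + 1 - fibℤ -[1+ suc (n ℕ.+ 0) ] * + a
        ≡⟨ cong (λ m → sign n * + fib (1 ℕ.+ n) * + 1 - fibℤ -[1+ suc m ] * + a) (ℕ.+-identityʳ n) ⟩
      sign n * + fib (1 ℕ.+ n) * + 1 - (- sign n) * + fib (2 ℕ.+ n) * + a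
        ≡⟨ factor (sign n) (+ fib (1 ℕ.+ n)) (+ fib (2 ℕ.+ n)) (+ a) ⟩
      sign n * (+ fib (1 ℕ.+ n) + + a * + fib (2 ℕ.+ n))
        ≡⟨ cong (λ z → sign n * (+ fib (1 ℕ.+ n) + z)) (pos-* a (fib (2 ℕ.+ n))) ⟨
      sign n * + (fib (1 ℕ.+ n) ℕ.+ a ℕ.* fib (2 ℕ.+ n)) ∎
      where
      open ≡-Reasoning
      factor : ∀ σ f g a → σ * f * + 1 - (- σ) * g * a ≡ σ * (f + a * g)
      factor = ℤ-Solver.solve-∀

    weight-pos : ∀ n → 1 ℕ.≤ fib (1 ℕ.+ n) ℕ.+ a ℕ.* fib (2 ℕ.+ n)
    weight-pos n = ℕ.≤-trans (fib-pos n) (ℕ.m≤m+n _ _)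

    fibForm-at-neg-even : ∀ j → 0ℤ < fibForm (a , 1) -[1+ 2 ℕ.* j ]
    fibForm-at-neg-even j = subst (0ℤ <_) (sym value) (+<+ (weight-pos (2 ℕ.* j)))
      where
      value : fibForm (a , 1) -[1+ 2 ℕ.* j ] ≡ + (fib (1 ℕ.+ 2 ℕ.* j) ℕ.+ a ℕ.* fib (2 ℕ.+ 2 ℕ.* j))
      value = trans (fibForm-at-neg (2 ℕ.* j)) (trans (cong (_* + weight) (sign-even j)) (*-identityˡ (+ weight)))
        where
        weight : ℕ
        weight = fib (1 ℕ.+ 2 ℕ.* j) ℕ.+ a ℕ.* fib (2 ℕ.+ 2 ℕ.* j)

    fibForm-at-neg-odd : ∀ j → fibForm (a , 1) -[1+ suc (2 ℕ.* j) ] < 0ℤ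
    fibForm-at-neg-odd j = subst (_< 0ℤ) (sym value) (neg-mono-< (+<+ (weight-pos (suc (2 ℕ.* j)))))
      where
      value : fibForm (a , 1) -[1+ suc (2 ℕ.* j) ] ≡ - + (fib (2 ℕ.+ 2 ℕ.* j) ℕ.+ a ℕ.* fib (3 ℕ.+ 2 ℕ.* j))
      value = trans (fibForm-at-neg (suc (2 ℕ.* j))) (trans (cong (_* + weight) (sign-odd j)) (-1*i≡-i (+ weight)))
        where
        weight : ℕ
        weight = fib (2 ℕ.+ 2 ℕ.* j) ℕ.+ a ℕ.* fib (3 ℕ.+ 2 ℕ.* j)

    G : ℕ → ℕ → ℕ
    G r = branchBound r (a , 1)

    ascent : ∀ r i → 2 ℕ.* suc i ℕ.< r → fibForm (a , 1) (+ r - + 4 * + i) < 0ℤ → G r i ℕ.< G r (suc i)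
    ascent r i 2i+2<r t<0 = drop‿+<+ (diff<0⇒< (subst (_< 0ℤ) (sym (branchBound-diff i r (a , 1) 2i+2<r)) t<0))

    descent : ∀ r i → 2 ℕ.* suc i ℕ.< r → 0ℤ < fibForm (a , 1) (+ r - + 4 * + i) → G r (suc i) ℕ.< G r i
    descent r i 2i+2<r 0<t = drop‿+<+ (0<diff⇒> (subst (0ℤ <_) (sym (branchBound-diff i r (a , 1) 2i+2<r)) 0<t))

    plateau : ∀ r i → 2 ℕ.* suc i ℕ.< r → 0ℤ ≤ fibForm (a , 1) (+ r - + 4 * + i) → G r (suc i) ℕ.≤ G r i
    plateau r i 2i+2<r 0≤t = drop‿+≤+ (0≤i-j⇒j≤i (subst (0ℤ ≤_) (sym (branchBound-diff i r (a , 1) 2i+2<r)) 0≤t))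

    -- Before the q-th branch the index t = r - 4i is at least 4.
    ascent-before : ∀ {r q ρ} i → i ℕ.< q → r ≡ 4 ℕ.* q ℕ.+ ρ → 2 ℕ.* suc i ℕ.< r → G r i ℕ.< G r (suc i)
    ascent-before {r} {q} {ρ} i i<q r≡ 2i+2<r with ℕ.m≤n⇒∃[o]m+o≡n i<q
    ... | d , refl = ascent r i 2i+2<r (subst (λ t → fibForm (a , 1) t < 0ℤ) (sym t≡)
                       (fibForm-at-2+ (2 ℕ.+ 4 ℕ.* d ℕ.+ ρ) (fib<a*fib (2 ℕ.+ 4 ℕ.* d ℕ.+ ρ) λ ())))
      where
      t≡ : + r - + 4 * + i ≡ + (2 ℕ.+ (2 ℕ.+ 4 ℕ.* d ℕ.+ ρ))
      t≡ = trans (index-below {q = q} {ρ = ρ} i (suc d) r≡ (sym (ℕ.+-suc i d))) (cong (λ z → + (z ℕ.+ ρ)) (ℕ.*-suc 4 d))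

    ascent-≡0 : ∀ {r q} → r ≡ 4 ℕ.* q ℕ.+ 0 → ∀ i → 2 ℕ.* suc i ℕ.< r → G r i ℕ.< G r (suc i)
    ascent-≡0 {r} {q} r≡ i 2i+2<r with offset-view q i
    ... | inj₁ (suc d , q≡) = ascent-before i (subst (i ℕ.<_) (sym q≡) (ℕ.m<m+n i ℕ.z<s)) r≡ 2i+2<r
    ... | inj₁ (zero , q≡) = ascent r i 2i+2<r
          (subst (λ t → fibForm (a , 1) t < 0ℤ) (sym (index-below {q = q} {ρ = 0} i 0 r≡ q≡)) fibForm-at-0)
    ... | inj₂ (e , refl) = ascent r i 2i+2<r
          (subst (λ t → fibForm (a , 1) t < 0ℤ) (sym (index-above {q = q} {ρ = 0} e (suc (2 ℕ.* (2 ℕ.* e ℕ.+ 1))) r≡ (fours e)))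
                 (fibForm-at-neg-odd (2 ℕ.* e ℕ.+ 1)))
      where
      fours : ∀ e → 0 ℕ.+ suc (suc (2 ℕ.* (2 ℕ.* e ℕ.+ 1))) ≡ 4 ℕ.* suc e
      fours = ℕ-Solver.solve-∀

    ascent-≡2 : ∀ {r q} → r ≡ 4 ℕ.* q ℕ.+ 2 → ∀ i → 2 ℕ.* suc i ℕ.< r → G r i ℕ.< G r (suc i)
    ascent-≡2 {r} {q} r≡ i 2i+2<r with offset-view q i
    ... | inj₁ (suc d , q≡) = ascent-before i (subst (i ℕ.<_) (sym q≡) (ℕ.m<m+n i ℕ.z<s)) r≡ 2i+2<r
    ... | inj₁ (zero , q≡) = ascent r i 2i+2<r
          (subst (λ t → fibForm (a , 1) t < 0ℤ) (sym (index-below {q = q} {ρ = 2} i 0 r≡ q≡)) (fibForm-at-2+ 0 (fib<a*fib 0 λ ())))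
    ... | inj₂ (e , refl) = ascent r i 2i+2<r
          (subst (λ t → fibForm (a , 1) t < 0ℤ) (sym (index-above {q = q} {ρ = 2} e (suc (2 ℕ.* (2 ℕ.* e))) r≡ (fours e)))
                 (fibForm-at-neg-odd (2 ℕ.* e)))
      where
      fours : ∀ e → 2 ℕ.+ suc (suc (2 ℕ.* (2 ℕ.* e))) ≡ 4 ℕ.* suc e
      fours = ℕ-Solver.solve-∀

    descent-≡1 : ∀ {r q} → r ≡ 4 ℕ.* q ℕ.+ 1 → ∀ i → q ℕ.≤ i → 2 ℕ.* suc i ℕ.< r → G r (suc i) ℕ.< G r i
    descent-≡1 {r} {q} r≡ i q≤i 2i+2<r with offset-view q i
    ... | inj₁ (zero , q≡) = descent r i 2i+2<r
          (subst (λ t → 0ℤ < fibForm (a , 1) t) (sym (index-below {q = q} {ρ = 1} i 0 r≡ q≡)) fibForm-at-1)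
    ... | inj₁ (suc d , q≡) = contradiction q≤i (ℕ.<⇒≱ (subst (i ℕ.<_) (sym q≡) (ℕ.m<m+n i ℕ.z<s)))
    ... | inj₂ (e , refl) = descent r i 2i+2<r
          (subst (λ t → 0ℤ < fibForm (a , 1) t) (sym (index-above {q = q} {ρ = 1} e (2 ℕ.* (2 ℕ.* e ℕ.+ 1)) r≡ (fours e)))
                 (fibForm-at-neg-even (2 ℕ.* e ℕ.+ 1)))
      where
      fours : ∀ e → 1 ℕ.+ suc (2 ℕ.* (2 ℕ.* e ℕ.+ 1)) ≡ 4 ℕ.* suc e
      fours = ℕ-Solver.solve-∀

    descent-≡3 : ∀ {r q} → r ≡ 4 ℕ.* q ℕ.+ 3 → ∀ i → q ℕ.< i → 2 ℕ.* suc i ℕ.< r → G r (suc i) ℕ.< G r i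
    descent-≡3 {r} {q} r≡ i q<i 2i+2<r with offset-view q i
    ... | inj₁ (d , q≡) = contradiction q<i (ℕ.≤⇒≯ (subst (i ℕ.≤_) (sym q≡) (ℕ.m≤m+n i d)))
    ... | inj₂ (e , refl) = descent r i 2i+2<r
          (subst (λ t → 0ℤ < fibForm (a , 1) t) (sym (index-above {q = q} {ρ = 3} e (2 ℕ.* (2 ℕ.* e)) r≡ (fours e)))
                 (fibForm-at-neg-even (2 ℕ.* e)))
      where
      fours : ∀ e → 3 ℕ.+ suc (2 ℕ.* (2 ℕ.* e)) ≡ 4 ℕ.* suc e
      fours = ℕ-Solver.solve-∀

    at-q : ∀ {r q} → r ≡ 4 ℕ.* q ℕ.+ 3 → + r - + 4 * + q ≡ + 3
    at-q {q = q} r≡ = index-below {q = q} {ρ = 3} q 0 r≡ (sym (ℕ.+-identityʳ q))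

    ascent-≡3-at-q : ∀ {r q} → r ≡ 4 ℕ.* q ℕ.+ 3 → 1 ℕ.≤ a′ → 2 ℕ.* suc q ℕ.< r → G r q ℕ.< G r (suc q)
    ascent-≡3-at-q {r} {q} r≡ 1≤a′ 2q+2<r = ascent r q 2q+2<r
      (subst (λ t → fibForm (a , 1) t < 0ℤ) (sym (at-q {q = q} r≡)) (fibForm-at-2+ 1 (s≤s (s≤s (subst (1 ℕ.≤_) (sym (ℕ.*-identityʳ a′)) 1≤a′)))))

    plateau-≡3-at-q : ∀ {r q} → r ≡ 4 ℕ.* q ℕ.+ 3 → a′ ≡ 0 → 2 ℕ.* suc q ℕ.< r → G r (suc q) ℕ.≤ G r q
    plateau-≡3-at-q {r} {q} r≡ a′≡0 2q+2<r = plateau r q 2q+2<r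
      (subst (λ t → 0ℤ ≤ fibForm (a , 1) t) (sym (at-q {q = q} r≡)) (fibForm-at-3 a′≡0))

module Counting where

  open import Data.Nat
  open import Data.Nat.Properties
  open import Data.Nat.GeneralisedArithmetic using (iterate)
  open import Data.List using (List; []; _∷_; _++_; map; concatMap; filter; length; upTo; applyUpTo; foldl)
  open import Data.Nat.ListAction using (sum)
  open import Data.List.Properties using (filter-++; length-++; foldl-++)
  open import Data.Product using (_×_; _,_; proj₁; proj₂)
  open import Data.Sum using (inj₁; inj₂)
  open import Data.Empty using (⊥; ⊥-elim)
  open import Relation.Nullary using (yes; no)
  open import Relation.Nullary.Decidable using (_×-dec_)
  open import Relation.Binary.Definitions using (tri<; tri≈; tri>)
  open import Relation.Unary using (Pred; Decidable)
  open import Relation.Binary.PropositionalEquality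
  open import Function using (_∘_; id)
  open import Level using (0ℓ)
  import Data.Nat.Tactic.RingSolver as ℕ-Solver
  open import Defs
  open Automaton using (Coeffs; read0; read1; readDigit)

  module Values (b : ℕ) where

    foldl-value : ∀ acc w → foldl (λ acc d → acc * b + d) acc w ≡ acc * b ^ length w + value b w
    foldl-value acc [] = sym (trans (+-identityʳ _) (*-identityʳ acc))
    foldl-value acc (x ∷ w) = trans (foldl-value (acc * b + x) w)
      (trans (regroup acc b x (b ^ length w) (value b w)) (cong (λ v → acc * (b * b ^ length w) + v) (sym (foldl-value x w))))
      where
      regroup : ∀ acc b x P v → (acc * b + x) * P + v ≡ acc * (b * P) + (x * P + v)
      regroup = ℕ-Solver.solve-∀

    value-∷ : ∀ d w → value b (d ∷ w) ≡ d * b ^ length w + value b w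
    value-∷ = foldl-value

    value-++ : ∀ u w → value b (u ++ w) ≡ value b u * b ^ length w + value b w
    value-++ u w = trans (foldl-++ (λ acc d → acc * b + d) 0 u w) (foldl-value (value b u) w)

  countWhere : {P : Pred (List ℕ) 0ℓ} → Decidable P → List (List ℕ) → ℕ
  countWhere P? xs = length (filter P? xs)

  countWhere-++ : ∀ {P : Pred (List ℕ) 0ℓ} (P? : Decidable P) xs ys →
                  countWhere P? (xs ++ ys) ≡ countWhere P? xs + countWhere P? ys
  countWhere-++ P? xs ys = trans (cong length (filter-++ P? xs ys)) (length-++ (filter P? xs))

  countWhere-concatMap : ∀ {P : Pred (List ℕ) 0ℓ} (P? : Decidable P) (f : ℕ → List (List ℕ)) xs →
    countWhere P? (concatMap f xs) ≡ sum (map (λ x → countWhere P? (f x)) xs)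
  countWhere-concatMap P? f [] = refl
  countWhere-concatMap P? f (x ∷ xs) =
    trans (countWhere-++ P? (f x) (concatMap f xs)) (cong (countWhere P? (f x) +_) (countWhere-concatMap P? f xs))

  countWhere-map : ∀ {P : Pred (List ℕ) 0ℓ} (P? : Decidable P) (g : List ℕ → List ℕ) xs →
    countWhere P? (map g xs) ≡ countWhere (P? ∘ g) xs
  countWhere-map P? g [] = refl
  countWhere-map P? g (x ∷ xs) with P? (g x)
  ... | yes _ = cong suc (countWhere-map P? g xs)
  ... | no _ = countWhere-map P? g xs

  countWhere-none : ∀ xs → countWhere {P = λ _ → ⊥} (λ _ → no id) xs ≡ 0
  countWhere-none [] = refl
  countWhere-none (_ ∷ xs) = countWhere-none xs

  sumBelow : ℕ → (ℕ → ℕ) → ℕ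
  sumBelow zero g = 0
  sumBelow (suc n) g = sumBelow n g + g n

  sumBelow-front : ∀ n g → sumBelow (suc n) g ≡ g 0 + sumBelow n (g ∘ suc)
  sumBelow-front zero g = +-comm 0 (g 0)
  sumBelow-front (suc n) g = trans (cong (_+ g (suc n)) (sumBelow-front n g)) (+-assoc (g 0) _ _)

  sum-map-applyUpTo : ∀ n (f g : ℕ → ℕ) → sum (map g (applyUpTo f n)) ≡ sumBelow n (g ∘ f)
  sum-map-applyUpTo zero f g = refl
  sum-map-applyUpTo (suc n) f g =
    trans (cong (g (f 0) +_) (sum-map-applyUpTo n (f ∘ suc) g)) (sym (sumBelow-front n (g ∘ f)))

  sumBelow-cong : ∀ n g h → (∀ d → d < n → g d ≡ h d) → sumBelow n g ≡ sumBelow n h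
  sumBelow-cong zero g h e = refl
  sumBelow-cong (suc n) g h e = cong₂ _+_ (sumBelow-cong n g h (λ d d< → e d (m<n⇒m<1+n d<))) (e n (n<1+n n))

  sumBelow-zero : ∀ n g → (∀ d → d < n → g d ≡ 0) → sumBelow n g ≡ 0
  sumBelow-zero zero g e = refl
  sumBelow-zero (suc n) g e = cong₂ _+_ (sumBelow-zero n g (λ d d< → e d (m<n⇒m<1+n d<))) (e n (n<1+n n))

  -- For h vanishing from 2 on, only the terms h 0 and h 1 survive in the sum.
  module TwoTerms (h : ℕ → ℕ) (h-vanishes : ∀ j → 2 ≤ j → h j ≡ 0) where
    kernel : ℕ → ℕ → ℕ
    kernel K d with d ≤? K
    ... | yes _ = h (K ∸ d)
    ... | no _ = 0

    lowTerm : ℕ → ℕ → ℕ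
    lowTerm n K with K <? n
    ... | yes _ = h 0
    ... | no _ = 0

    highTerm : ℕ → ℕ → ℕ
    highTerm n zero = 0
    highTerm n (suc K) with K <? n
    ... | yes _ = h 1
    ... | no _ = 0

    kernel-≤ : ∀ K d → d ≤ K → kernel K d ≡ h (K ∸ d)
    kernel-≤ K d le with d ≤? K
    ... | yes _ = refl
    ... | no ¬p = ⊥-elim (¬p le)

    kernel-> : ∀ K d → K < d → kernel K d ≡ 0
    kernel-> K d lt with d ≤? K
    ... | yes p = ⊥-elim (<⇒≱ lt p)
    ... | no _ = refl

    lowTerm-< : ∀ n K → K < n → lowTerm n K ≡ h 0
    lowTerm-< n K lt with K <? n
    ... | yes _ = refl
    ... | no ¬p = ⊥-elim (¬p lt)

    lowTerm-≥ : ∀ n K → n ≤ K → lowTerm n K ≡ 0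
    lowTerm-≥ n K le with K <? n
    ... | yes p = ⊥-elim (<⇒≱ p le)
    ... | no _ = refl

    highTerm-< : ∀ n K → K < n → highTerm n (suc K) ≡ h 1
    highTerm-< n K lt with K <? n
    ... | yes _ = refl
    ... | no ¬p = ⊥-elim (¬p lt)

    highTerm-≥ : ∀ n K → n ≤ K → highTerm n (suc K) ≡ 0
    highTerm-≥ n K le with K <? n
    ... | yes p = ⊥-elim (<⇒≱ p le)
    ... | no _ = refl

    sumBelow-kernel : ∀ n K → sumBelow n (kernel K) ≡ lowTerm n K + highTerm n K
    sumBelow-kernel zero K = sym (cong₂ _+_ (lowTerm-≥ 0 K z≤n) (highTerm-0 K))
      where highTerm-0 : ∀ K → highTerm 0 K ≡ 0
            highTerm-0 zero = refl
            highTerm-0 (suc K) = highTerm-≥ 0 K z≤n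
    sumBelow-kernel (suc n) K with <-cmp K n
    ... | tri< K<n _ _ = begin
        sumBelow n (kernel K) + kernel K n ≡⟨ cong₂ _+_ (sumBelow-kernel n K) (kernel-> K n K<n) ⟩
        lowTerm n K + highTerm n K + 0 ≡⟨ +-identityʳ _ ⟩
        lowTerm n K + highTerm n K ≡⟨ cong₂ _+_ (trans (lowTerm-< n K K<n) (sym (lowTerm-< (suc n) K (m<n⇒m<1+n K<n)))) (highTerm-stable K K<n) ⟩
        lowTerm (suc n) K + highTerm (suc n) K ∎
        where
        open ≡-Reasoning
        highTerm-stable : ∀ K → K < n → highTerm n K ≡ highTerm (suc n) K
        highTerm-stable zero _ = refl
        highTerm-stable (suc K) lt = trans (highTerm-< n K (<-trans (n<1+n K) lt)) (sym (highTerm-< (suc n) K (<-trans (n<1+n K) (m<n⇒m<1+n lt))))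
    ... | tri≈ _ refl _ = begin
        sumBelow K (kernel K) + kernel K K ≡⟨ cong₂ _+_ (sumBelow-kernel K K) (kernel-≤ K K ≤-refl) ⟩
        lowTerm K K + highTerm K K + h (K ∸ K) ≡⟨ cong (λ v → lowTerm K K + highTerm K K + h v) (n∸n≡0 K) ⟩
        lowTerm K K + highTerm K K + h 0 ≡⟨ cong (λ v → v + highTerm K K + h 0) (lowTerm-≥ K K ≤-refl) ⟩
        highTerm K K + h 0 ≡⟨ +-comm (highTerm K K) (h 0) ⟩
        h 0 + highTerm K K ≡⟨ cong₂ _+_ (sym (lowTerm-< (suc K) K (n<1+n K))) (highTerm-stable K) ⟩
        lowTerm (suc K) K + highTerm (suc K) K ∎
        where
        open ≡-Reasoning
        highTerm-stable : ∀ K → highTerm K K ≡ highTerm (suc K) K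
        highTerm-stable zero = refl
        highTerm-stable (suc K) = trans (highTerm-< (suc K) K (n<1+n K)) (sym (highTerm-< (suc (suc K)) K (m<n⇒m<1+n (n<1+n K))))
    ... | tri> _ _ n<K with m≤n⇒m<n∨m≡n n<K
    ... | inj₂ refl = begin
        sumBelow n (kernel (suc n)) + kernel (suc n) n ≡⟨ cong₂ _+_ (sumBelow-kernel n (suc n)) (kernel-≤ (suc n) n (n≤1+n n)) ⟩
        lowTerm n (suc n) + highTerm n (suc n) + h (suc n ∸ n) ≡⟨ cong₂ (λ u v → u + v + h (suc n ∸ n)) (lowTerm-≥ n (suc n) (n≤1+n n)) (highTerm-≥ n n ≤-refl) ⟩
        h (suc n ∸ n) ≡⟨ cong h (m+n∸n≡m 1 n) ⟩
        h 1 ≡⟨ cong₂ _+_ (sym (lowTerm-≥ (suc n) (suc n) ≤-refl)) (sym (highTerm-< (suc n) n (n<1+n n))) ⟩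
        lowTerm (suc n) (suc n) + highTerm (suc n) (suc n) ∎
        where open ≡-Reasoning
    ... | inj₁ sn<K = begin
        sumBelow n (kernel K) + kernel K n ≡⟨ cong₂ _+_ (sumBelow-kernel n K) (trans (kernel-≤ K n (<⇒≤ n<K)) (h-vanishes (K ∸ n) 2≤K∸n)) ⟩
        lowTerm n K + highTerm n K + 0 ≡⟨ +-identityʳ _ ⟩
        lowTerm n K + highTerm n K ≡⟨ cong₂ _+_ (trans (lowTerm-≥ n K (<⇒≤ n<K)) (sym (lowTerm-≥ (suc n) K (<⇒≤ sn<K)))) (highTerm-stable K sn<K) ⟩
        lowTerm (suc n) K + highTerm (suc n) K ∎
        where
        open ≡-Reasoning
        2≤K∸n : 2 ≤ K ∸ n
        2≤K∸n = subst (_≤ K ∸ n) (m+n∸n≡m 2 n) (∸-monoˡ-≤ n sn<K)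
        highTerm-stable : ∀ K → suc n < K → highTerm n K ≡ highTerm (suc n) K
        highTerm-stable (suc K) (s≤s lt) = trans (highTerm-≥ n K (<⇒≤ lt)) (sym (highTerm-≥ (suc n) K lt))

  module WordCounts (c : ℕ) where

    b : ℕ
    b = 2 + c

    open Values b

    words : ℕ → List (List ℕ)
    words = wordsOfLength b

    countWhere-words-suc : ∀ {P : Pred (List ℕ) 0ℓ} (P? : Decidable P) m →
      countWhere P? (words (suc m)) ≡ sumBelow (suc b) (λ d → countWhere (λ w → P? (d ∷ w)) (words m))
    countWhere-words-suc P? m =
      trans (countWhere-concatMap P? (λ d → map (d ∷_) (words m)) (upTo (suc b)))
      (trans (sum-map-applyUpTo (suc b) id (λ d → countWhere P? (map (d ∷_) (words m))))
             (sumBelow-cong (suc b) _ _ (λ d _ → countWhere-map P? (d ∷_) (words m))))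

    countWhere-words-cong : ∀ m {P Q : Pred (List ℕ) 0ℓ} (P? : Decidable P) (Q? : Decidable Q) →
      (∀ w → length w ≡ m → (P w → Q w) × (Q w → P w)) → countWhere P? (words m) ≡ countWhere Q? (words m)
    countWhere-words-cong zero P? Q? P⇔Q with P? [] | Q? []
    ... | yes _ | yes _ = refl
    ... | no _ | no _ = refl
    ... | yes p | no ¬q = ⊥-elim (¬q (proj₁ (P⇔Q [] refl) p))
    ... | no ¬p | yes q = ⊥-elim (¬p (proj₂ (P⇔Q [] refl) q))
    countWhere-words-cong (suc m) P? Q? P⇔Q = trans (countWhere-words-suc P? m) (trans
      (sumBelow-cong (suc b) _ _ (λ d _ → countWhere-words-cong m (λ w → P? (d ∷ w)) (λ w → Q? (d ∷ w))
                                           (λ w |w| → P⇔Q (d ∷ w) (cong suc |w|))))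
      (sym (countWhere-words-suc Q? m)))

    -- Unlike over-expansions, these words may have leading zeros.
    wordCount : ℕ → ℕ → ℕ
    wordCount m N = countWhere (λ w → value b w ≟ N) (words m)

    leadingCount : ℕ → ℕ → ℕ → ℕ
    leadingCount m N d = countWhere (λ w → value b (d ∷ w) ≟ N) (words m)

    wordCount-suc : ∀ m N → wordCount (suc m) N ≡ sumBelow (suc b) (leadingCount m N)
    wordCount-suc m N = countWhere-words-suc (λ w → value b w ≟ N) m

    value-∷-words : ∀ {m} d w → length w ≡ m → value b (d ∷ w) ≡ d * b ^ m + value b w
    value-∷-words d w refl = value-∷ d w

    leadingCount-≤ : ∀ m N d → d * b ^ m ≤ N → leadingCount m N d ≡ wordCount m (N ∸ d * b ^ m)
    leadingCount-≤ m N d d*b^m≤N = countWhere-words-cong m _ _ λ w |w| →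
      (λ eq → trans (sym (m+n∸m≡n (d * b ^ m) (value b w))) (cong (_∸ d * b ^ m) (trans (sym (value-∷-words d w |w|)) eq))) ,
      (λ eq → trans (value-∷-words d w |w|) (trans (cong (d * b ^ m +_) eq) (m+[n∸m]≡n d*b^m≤N)))

    leadingCount-> : ∀ m N d → N < d * b ^ m → leadingCount m N d ≡ 0
    leadingCount-> m N d N<d*b^m = trans (countWhere-words-cong m (λ w → value b (d ∷ w) ≟ N) (λ _ → no id)
      (λ w |w| → (λ eq → <⇒≱ N<d*b^m (subst (d * b ^ m ≤_) eq
                                   (subst (_≤ value b (d ∷ w)) (cong (λ l → d * b ^ l) |w|) (≤-big d w)))) , ⊥-elim))
      (countWhere-none (words m))
      where
      ≤-big : ∀ d w → d * b ^ length w ≤ value b (d ∷ w)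
      ≤-big d w = subst (d * b ^ length w ≤_) (sym (value-∷ d w)) (m≤m+n _ _)

    -- Digits are at most b, so a word of length m has value at most 2(bᵐ - 1).
    wordCount-large : ∀ m X → 2 * b ^ m ≤ suc X → wordCount m X ≡ 0
    wordCount-large zero zero (s≤s ())
    wordCount-large zero (suc X) _ = refl
    wordCount-large (suc m) X large = trans (wordCount-suc m X) (sumBelow-zero (suc b) (leadingCount m X) term)
      where
      term : ∀ d → d < suc b → leadingCount m X d ≡ 0
      term d d≤b with d * b ^ m ≤? X
      ... | no d*b^m≰X = leadingCount-> m X d (≰⇒> d*b^m≰X)
      ... | yes d*b^m≤X = trans (leadingCount-≤ m X d d*b^m≤X) (wordCount-large m (X ∸ d * b ^ m) still-large)
        where
        open ≤-Reasoning
        still-large : 2 * b ^ m ≤ suc (X ∸ d * b ^ m)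
        still-large = begin
          2 * b ^ m                         ≡⟨ m+n∸n≡m (2 * b ^ m) (d * b ^ m) ⟨
          2 * b ^ m + d * b ^ m ∸ d * b ^ m ≤⟨ ∸-monoˡ-≤ (d * b ^ m) (begin
              2 * b ^ m + d * b ^ m ≤⟨ +-monoʳ-≤ (2 * b ^ m) (*-monoˡ-≤ (b ^ m) (≤-pred d≤b)) ⟩
              2 * b ^ m + b * b ^ m ≤⟨ +-monoˡ-≤ (b * b ^ m) (*-monoˡ-≤ (b ^ m) {2} {b} (s≤s (s≤s z≤n))) ⟩
              b * b ^ m + b * b ^ m ≡⟨ cong (b * b ^ m +_) (+-identityʳ (b * b ^ m)) ⟨
              2 * (b * b ^ m)       ≤⟨ large ⟩
              suc X                 ∎) ⟩
          suc X ∸ d * b ^ m                 ≡⟨ +-∸-assoc 1 d*b^m≤X ⟩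
          suc (X ∸ d * b ^ m)               ∎

    -- Fixing the last m digits to those of R, only the leading digit varies.
    module Slice (m R : ℕ) (R<b^m : R < b ^ m) where

      slice : ℕ → ℕ
      slice j = wordCount m (j * b ^ m + R)

      slice-vanishes : ∀ j → 2 ≤ j → slice j ≡ 0
      slice-vanishes j 2≤j = wordCount-large m (j * b ^ m + R)
        (≤-trans (*-monoˡ-≤ (b ^ m) 2≤j) (≤-trans (m≤m+n (j * b ^ m) R) (n≤1+n _)))

      open TwoTerms slice slice-vanishes public

      wordCount-slice : ∀ K → wordCount (suc m) (K * b ^ m + R) ≡ lowTerm (suc b) K + highTerm (suc b) K
      wordCount-slice K = trans (wordCount-suc m (K * b ^ m + R))
        (trans (sumBelow-cong (suc b) _ _ term) (sumBelow-kernel (suc b) K))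
        where
        term : ∀ d → d < suc b → leadingCount m (K * b ^ m + R) d ≡ kernel K d
        term d _ with d ≤? K
        ... | yes d≤K = trans (leadingCount-≤ m (K * b ^ m + R) d (≤-trans (*-monoˡ-≤ (b ^ m) d≤K) (m≤m+n _ R)))
                          (cong (wordCount m) (trans (+-∸-comm R (*-monoˡ-≤ (b ^ m) d≤K))
                                                     (cong (_+ R) (sym (*-distribʳ-∸ (b ^ m) K d)))))
        ... | no d≰K = leadingCount-> m (K * b ^ m + R) d (begin-strict
            K * b ^ m + R     <⟨ +-monoʳ-< (K * b ^ m) R<b^m ⟩
            K * b ^ m + b ^ m ≡⟨ +-comm (K * b ^ m) (b ^ m) ⟩
            suc K * b ^ m     ≤⟨ *-monoˡ-≤ (b ^ m) (≰⇒> d≰K) ⟩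
            d * b ^ m         ∎)
          where open ≤-Reasoning

    pairCount : ℕ → Coeffs → ℕ → ℕ
    pairCount m (x , y) R = x * wordCount m R + y * wordCount m (b ^ m + R)

    pairCount-empty : ∀ s → pairCount 0 s 0 ≡ proj₁ s
    pairCount-empty (x , y) = simplify x y
      where
      simplify : ∀ x y → x * 1 + y * 0 ≡ x
      simplify = ℕ-Solver.solve-∀

    pairCount-digit : ∀ m s d R → d < b → R < b ^ m →
                      pairCount (suc m) s (d * b ^ m + R) ≡ pairCount m (readDigit d s) R
    pairCount-digit m (x , y) d R d<b R<b^m = begin
      x * wordCount (suc m) (d * b ^ m + R) + y * wordCount (suc m) (b ^ suc m + (d * b ^ m + R))
        ≡⟨ cong₂ (λ u v → x * u + y * v) (wordCount-slice d) (trans (cong (wordCount (suc m)) shift) (wordCount-slice (b + d))) ⟩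
      x * (lowTerm (suc b) d + highTerm (suc b) d) + y * (lowTerm (suc b) (b + d) + highTerm (suc b) (b + d))
        ≡⟨ by-digit d d<b ⟩
      pairCount m (readDigit d (x , y)) R ∎
      where
      open ≡-Reasoning
      open Slice m R R<b^m
      shift : b ^ suc m + (d * b ^ m + R) ≡ (b + d) * b ^ m + R
      shift = trans (sym (+-assoc (b * b ^ m) (d * b ^ m) R)) (cong (_+ R) (sym (*-distribʳ-+ (b ^ m) b d)))
      slice₁ : slice 1 ≡ wordCount m (b ^ m + R)
      slice₁ = cong (λ v → wordCount m (v + R)) (*-identityˡ (b ^ m))
      by-digit : ∀ d → d < b → x * (lowTerm (suc b) d + highTerm (suc b) d) + y * (lowTerm (suc b) (b + d) + highTerm (suc b) (b + d))
                              ≡ pairCount m (readDigit d (x , y)) R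
      by-digit zero _ = begin
        x * (lowTerm (suc b) 0 + 0) + y * (lowTerm (suc b) (b + 0) + highTerm (suc b) (b + 0))
          ≡⟨ cong₂ (λ u v → x * (u + 0) + y * v) (lowTerm-< (suc b) 0 z<s)
               (trans (cong (λ K → lowTerm (suc b) K + highTerm (suc b) K) (+-identityʳ b))
                 (cong₂ _+_ (lowTerm-< (suc b) b (n<1+n b)) (highTerm-< (suc b) (suc c) (m<n⇒m<1+n (n<1+n (suc c)))))) ⟩
        x * (slice 0 + 0) + y * (slice 0 + slice 1)     ≡⟨ cong (λ v → x * (slice 0 + 0) + y * (slice 0 + v)) slice₁ ⟩
        x * (slice 0 + 0) + y * (slice 0 + wordCount m (b ^ m + R)) ≡⟨ regroup x y (slice 0) (wordCount m (b ^ m + R)) ⟩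
        (x + y) * slice 0 + y * wordCount m (b ^ m + R) ∎
        where
        regroup : ∀ x y p q → x * (p + 0) + y * (p + q) ≡ (x + y) * p + y * q
        regroup = ℕ-Solver.solve-∀
      by-digit (suc zero) _ = begin
        x * (lowTerm (suc b) 1 + highTerm (suc b) 1) + y * (lowTerm (suc b) (b + 1) + highTerm (suc b) (b + 1))
          ≡⟨ cong₂ (λ u v → x * u + y * v) (cong₂ _+_ (lowTerm-< (suc b) 1 (s≤s z<s)) (highTerm-< (suc b) 0 z<s))
               (cong₂ _+_ (lowTerm-≥ (suc b) (b + 1) (≤-reflexive (+-comm 1 b)))
                          (highTerm-< (suc b) (suc c + 1) (s≤s (s≤s (≤-reflexive (+-comm c 1)))))) ⟩
        x * (slice 0 + slice 1) + y * (0 + slice 1) ≡⟨ cong (λ v → x * (slice 0 + v) + y * (0 + v)) slice₁ ⟩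
        x * (slice 0 + wordCount m (b ^ m + R)) + y * (0 + wordCount m (b ^ m + R)) ≡⟨ regroup x y (slice 0) (wordCount m (b ^ m + R)) ⟩
        x * slice 0 + (x + y) * wordCount m (b ^ m + R) ∎
        where
        regroup : ∀ x y p q → x * (p + q) + y * (0 + q) ≡ x * p + (x + y) * q
        regroup = ℕ-Solver.solve-∀
      by-digit (suc (suc d)) d<b = begin
        x * (lowTerm (suc b) (2 + d) + highTerm (suc b) (2 + d)) + y * (lowTerm (suc b) (b + (2 + d)) + highTerm (suc b) (b + (2 + d)))
          ≡⟨ cong₂ (λ u v → x * u + y * v)
               (cong₂ _+_ (lowTerm-< (suc b) (2 + d) (m<n⇒m<1+n d<b)) (highTerm-< (suc b) (suc d) (<-trans (n<1+n (suc d)) (m<n⇒m<1+n d<b))))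
               (cong₂ _+_ (lowTerm-≥ (suc b) (b + (2 + d)) (≤-trans (≤-reflexive (+-comm 1 b)) (+-monoʳ-≤ b (s≤s z≤n))))
                          (highTerm-≥ (suc b) (suc c + (2 + d)) (s≤s (≤-trans (≤-reflexive (+-comm 2 c)) (+-monoʳ-≤ c (s≤s (s≤s z≤n))))))) ⟩
        x * (slice 0 + slice 1) + y * (0 + 0)   ≡⟨ cong (λ v → x * (slice 0 + v) + y * (0 + 0)) slice₁ ⟩
        x * (slice 0 + wordCount m (b ^ m + R)) + y * (0 + 0) ≡⟨ regroup x y (slice 0) (wordCount m (b ^ m + R)) ⟩
        x * slice 0 + x * wordCount m (b ^ m + R) ∎
        where
        regroup : ∀ x y p q → x * (p + q) + y * (0 + 0) ≡ x * p + x * q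
        regroup = ℕ-Solver.solve-∀

    open Maximum.DigitRecursion c pairCount pairCount-empty pairCount-digit public hiding (b)

    isExpansion? : (N : ℕ) → Decidable (λ w → LeadingNonzero w × value b w ≡ N)
    isExpansion? N w = leadingNonzero? w ×-dec (value b w ≟ N)

    expansionCount : ℕ → ℕ → ℕ
    expansionCount N ℓ = countWhere (isExpansion? N) (words ℓ)

    countWhere-leading0 : ∀ N xs → countWhere (λ w → isExpansion? N (0 ∷ w)) xs ≡ 0
    countWhere-leading0 N [] = refl
    countWhere-leading0 N (_ ∷ xs) = countWhere-leading0 N xs

    wordCount-suc-split : ∀ N m → wordCount (suc m) N ≡ wordCount m N + expansionCount N (suc m)
    wordCount-suc-split N m = begin
      wordCount (suc m) N                                        ≡⟨ wordCount-suc m N ⟩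
      sumBelow (suc b) (leadingCount m N)                        ≡⟨ sumBelow-front b (leadingCount m N) ⟩
      wordCount m N + sumBelow b (λ d → leadingCount m N (suc d)) ≡⟨ cong (wordCount m N +_) nonzero-leading ⟨
      wordCount m N + expansionCount N (suc m)                   ∎
      where
      open ≡-Reasoning
      nonzero-leading : expansionCount N (suc m) ≡ sumBelow b (λ d → leadingCount m N (suc d))
      nonzero-leading =
        trans (countWhere-words-suc (isExpansion? N) m)
        (trans (sumBelow-front b (λ d → countWhere (λ w → isExpansion? N (d ∷ w)) (words m)))
        (trans (cong (_+ sumBelow b (λ d → countWhere (λ w → isExpansion? N (suc d ∷ w)) (words m))) (countWhere-leading0 N (words m)))
               (sumBelow-cong b _ _ (λ d _ → countWhere-words-cong m (λ w → isExpansion? N (suc d ∷ w)) (λ w → value b (suc d ∷ w) ≟ N)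
                                                 (λ w _ → proj₂ , λ eq → (λ ()) , eq)))))

    sumBelow-expansionCount : ∀ N L → sumBelow (suc L) (expansionCount (suc N)) ≡ wordCount L (suc N)
    sumBelow-expansionCount N zero = refl
    sumBelow-expansionCount N (suc L) =
      trans (cong (_+ expansionCount (suc N) (suc L)) (sumBelow-expansionCount N L)) (sym (wordCount-suc-split (suc N) L))

    s≡wordCount : ∀ N → 1 ≤ N → s b (suc N) ≡ wordCount (suc N) N
    s≡wordCount (suc N) _ =
      trans (countWhere-concatMap (isExpansion? (suc N)) words (upTo (3 + N)))
      (trans (sum-map-applyUpTo (3 + N) id (expansionCount (suc N))) (sumBelow-expansionCount N (2 + N)))

    wordCount-suc-stable : ∀ m N → N < b ^ m → wordCount (suc m) N ≡ wordCount m N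
    wordCount-suc-stable m N N<b^m = trans (wordCount-slice 0) (trans (cong (_+ 0) (lowTerm-< (suc b) 0 z<s)) (+-identityʳ _))
      where open Slice m N N<b^m

    wordCount-stable : ∀ t m N → N < b ^ m → wordCount (t + m) N ≡ wordCount m N
    wordCount-stable zero m N _ = refl
    wordCount-stable (suc t) m N N<b^m =
      trans (wordCount-suc-stable (t + m) N (<-≤-trans N<b^m (^-monoʳ-≤ b (m≤n+m m t)))) (wordCount-stable t m N N<b^m)

    n≤b^n : ∀ n → n ≤ b ^ n
    n≤b^n zero = z≤n
    n≤b^n (suc n) = ≤-trans (+-mono-≤ (m^n>0 b n) (n≤b^n n)) (+-monoʳ-≤ (b ^ n) (m≤m+n (b ^ n) _))

    pairCount-read0s : ∀ t m s j → j < b ^ m → pairCount (t + m) s j ≡ pairCount m (iterate read0 s t) j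
    pairCount-read0s zero m s j _ = refl
    pairCount-read0s (suc t) m s j j<b^m =
      trans (ev-read0 (t + m) s j (<-≤-trans j<b^m (^-monoʳ-≤ b (m≤n+m m t)))) (pairCount-read0s t m (read0 s) j j<b^m)

    iterate-read0 : ∀ t x → iterate read0 (x , 1) t ≡ (x + t , 1)
    iterate-read0 zero x = cong (_, 1) (sym (+-identityʳ x))
    iterate-read0 (suc t) x = trans (iterate-read0 t (x + 1)) (cong (_, 1) (+-assoc x 1 t))

    -- On the interval bᵏ < n ≤ bᵏ + bʳ⁺¹ the leading digit 1 of n - 1 and the
    -- zeros after it are read off, leaving the pair (k - r , 1).
    s-on-interval : ∀ t r j → j < b ^ suc r → s b (b ^ (t + suc r) + suc j) ≡ pairCount (suc r) (suc t , 1) j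
    s-on-interval t r j j<b^r+1 = begin
      s b (b ^ k + suc j)                           ≡⟨ cong (s b) (+-suc (b ^ k) j) ⟩
      s b (suc N)                                   ≡⟨ s≡wordCount N (≤-trans (m^n>0 b k) (m≤m+n _ j)) ⟩
      wordCount (suc N) N                           ≡⟨ cong (λ l → wordCount l N) (trans (+-suc (N ∸ k) k) (cong suc (m∸n+n≡m k≤N))) ⟨
      wordCount ((N ∸ k) + suc k) N                 ≡⟨ wordCount-stable (N ∸ k) (suc k) N N<b^k+1 ⟩
      wordCount (suc k) N                           ≡⟨ drop-zero (wordCount (suc k) N) (wordCount (suc k) (b ^ suc k + N)) ⟨
      pairCount (suc k) (1 , 0) (b ^ k + j)         ≡⟨ ev-read1 k (1 , 0) j j<b^k ⟩
      pairCount k (1 , 1) j                         ≡⟨ pairCount-read0s t (suc r) (1 , 1) j j<b^r+1 ⟩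
      pairCount (suc r) (iterate read0 (1 , 1) t) j ≡⟨ cong (λ s → pairCount (suc r) s j) (iterate-read0 t 1) ⟩
      pairCount (suc r) (suc t , 1) j               ∎
      where
      open ≡-Reasoning
      k N : ℕ
      k = t + suc r
      N = b ^ k + j
      j<b^k : j < b ^ k
      j<b^k = <-≤-trans j<b^r+1 (^-monoʳ-≤ b (m≤n+m (suc r) t))
      k≤N : k ≤ N
      k≤N = ≤-trans (n≤b^n k) (m≤m+n _ j)
      N<b^k+1 : N < b ^ suc k
      N<b^k+1 = <-≤-trans (+-monoʳ-< (b ^ k) j<b^k) (+-monoʳ-≤ (b ^ k) (m≤m+n (b ^ k) _))
      drop-zero : ∀ p q → 1 * p + 0 * q ≡ p
      drop-zero = ℕ-Solver.solve-∀

module Proof where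

  open import Data.Nat
  open import Data.Nat.Properties
  open import Data.Nat.DivMod
  open import Data.List using (List; []; _∷_; _++_; map; applyUpTo; length; replicate; foldr; upTo)
  open import Data.List.Properties using (length-++; length-replicate)
  open import Data.Product using (_×_; _,_; proj₁; proj₂)
  open import Data.Sum using (inj₁; inj₂)
  open import Data.Empty using (⊥-elim)
  open import Relation.Nullary using (yes; no; ¬_; contradiction)
  open import Relation.Binary.PropositionalEquality
  open import Function using (_∘_)
  import Data.Integer as ℤ
  import Data.Rational as ℚ
  open import Data.Rational.Properties using (fromℚᵘ-cong)
  open import Data.Rational.Unnormalised using (mkℚᵘ; *≡*)
  import Data.Integer.Tactic.RingSolver as ℤ-Solver
  import Data.Nat.Tactic.RingSolver as ℕ-Solver
  open import Defs
  open Automaton using (branchBound)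
  open Maximum using (twice-suc≤)
  open Lucas using (numerator≡5*branchBound)
  open Unimodality using (unimodal-peak; module Signs)
  open Counting using (module Values; module WordCounts)

  map-applyUpTo : ∀ (g f : ℕ → ℕ) n → map g (applyUpTo f n) ≡ applyUpTo (g ∘ f) n
  map-applyUpTo g f zero = refl
  map-applyUpTo g f (suc n) = cong (g (f 0) ∷_) (map-applyUpTo g (f ∘ suc) n)

  max-≤ : ∀ n (g : ℕ → ℕ) {M} → (∀ j → j < n → g j ≤ M) → foldr _⊔_ 0 (applyUpTo g n) ≤ M
  max-≤ zero g _ = z≤n
  max-≤ (suc n) g bounded = ⊔-lub (bounded 0 z<s) (max-≤ n (g ∘ suc) (λ j j<n → bounded (suc j) (s≤s j<n)))

  ≤-max : ∀ n (g : ℕ → ℕ) j → j < n → g j ≤ foldr _⊔_ 0 (applyUpTo g n)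
  ≤-max (suc n) g zero _ = m≤m⊔n _ _
  ≤-max (suc n) g (suc j) (s≤s j<n) = ≤-trans (≤-max n (g ∘ suc) j j<n) (m≤n⊔m _ _)

  firstWith-applyUpTo : ∀ b n (f : ℕ → ℕ) {M} j₀ → j₀ < n → s b (f j₀) ≡ M → (∀ j → j < j₀ → s b (f j) < M) →
                        firstWith b M (applyUpTo f n) ≡ f j₀
  firstWith-applyUpTo b (suc n) f {M} zero _ hit _ with s b (f 0) ≟ M
  ... | yes _ = refl
  ... | no miss = ⊥-elim (miss hit)
  firstWith-applyUpTo b (suc n) f {M} (suc j₀) (s≤s j₀<n) hit earlier with s b (f 0) ≟ M
  ... | yes early = ⊥-elim (<-irrefl early (earlier 0 z<s))
  ... | no _ = firstWith-applyUpTo b n (f ∘ suc) j₀ j₀<n hit (λ j j<j₀ → earlier (suc j) (s≤s j<j₀))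

  sumTo-cong : ∀ y f g → (∀ i → f i ≡ g i) → sumTo y f ≡ sumTo y g
  sumTo-cong zero f g f≗g = f≗g 0
  sumTo-cong (suc y) f g f≗g = cong₂ _+_ (sumTo-cong y f g f≗g) (f≗g (suc y))

  sumTo-front : ∀ y f → sumTo (suc y) f ≡ f 0 + sumTo y (f ∘ suc)
  sumTo-front zero f = refl
  sumTo-front (suc y) f = trans (cong (_+ f (suc (suc y))) (sumTo-front y f)) (+-assoc (f 0) _ _)

  oddTail : ℕ → List ℕ
  oddTail zero = []
  oddTail (suc _) = 0 ∷ []

  w≡ : ∀ k r x → w k r x ≡ 1 ∷ replicate (k ∸ r ∸ 1) 0 ++ rep10 x ++ 0 ∷ rep10 (r / 2 ∸ x) ++ oddTail (r % 2)
  w≡ k r x with r % 2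
  ... | zero = refl
  ... | suc _ = refl

  length-oddTail : ∀ p → p < 2 → length (oddTail p) ≡ p
  length-oddTail zero _ = refl
  length-oddTail (suc zero) _ = refl
  length-oddTail (suc (suc _)) (s≤s (s≤s ()))

  length-rep10 : ∀ m → length (rep10 m) ≡ 2 * m
  length-rep10 zero = refl
  length-rep10 (suc m) = trans (cong (suc ∘ suc) (length-rep10 m)) (sym (*-suc 2 m))

  module WordValues (c : ℕ) where
    open WordCounts c using (b; descPeak; span; peakAt)
    open Values b

    value-zeros : ∀ n → value b (replicate n 0) ≡ 0
    value-zeros zero = refl
    value-zeros (suc n) = value-zeros n

    value-alternating : ∀ m p → value b (rep10 m ++ oddTail p) ≡ descPeak (2 * m + length (oddTail p))
    value-alternating zero zero = refl
    value-alternating zero (suc p) = refl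
    value-alternating (suc m) p = trans (value-∷ 1 (0 ∷ rep10 m ++ oddTail p))
      (trans (cong₂ _+_ (trans (*-identityˡ _) (cong (λ l → b ^ suc l) length≡)) (value-alternating m p))
             (cong (λ n → descPeak (n + length (oddTail p))) (sym (*-suc 2 m))))
      where
      length≡ : length (rep10 m ++ oddTail p) ≡ 2 * m + length (oddTail p)
      length≡ = trans (length-++ (rep10 m)) (cong (_+ length (oddTail p)) (length-rep10 m))

    value-rep10-++ : ∀ x n v → 2 * x ≤ n → length v ≡ suc (n ∸ 2 * x) → value b v ≡ descPeak (n ∸ 2 * x) →
                     value b (rep10 x ++ v) ≡ peakAt n x
    value-rep10-++ zero n v _ _ value-v = value-v
    value-rep10-++ (suc x) n v 2x+2≤n length-v value-v with twice-suc≤ 2x+2≤n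
    ... | m , refl , 2x≤m = trans (value-∷ 1 (0 ∷ rep10 x ++ v))
        (cong₂ _+_ (trans (*-identityˡ _) (cong (λ l → b ^ suc l) length≡))
                   (value-rep10-++ x m v 2x≤m length-v′ (trans value-v (cong descPeak shift))))
      where
      shift : 2 + m ∸ 2 * suc x ≡ m ∸ 2 * x
      shift = cong (2 + m ∸_) (*-suc 2 x)
      length-v′ : length v ≡ suc (m ∸ 2 * x)
      length-v′ = trans length-v (cong suc shift)
      length≡ : length (rep10 x ++ v) ≡ suc m
      length≡ = trans (length-++ (rep10 x))
        (trans (cong₂ _+_ (length-rep10 x) length-v′) (trans (+-suc (2 * x) _) (cong suc (m+[n∸m]≡n 2x≤m))))

    length-span : ∀ y r → intervalLength b r y ≡ span r y
    length-span zero r = refl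
    length-span (suc y) r = trans (sumTo-front y (λ i → b ^ (r ∸ 2 * i)))
      (cong (b ^ r +_) (trans (sumTo-cong y _ (λ i → b ^ (r ∸ 2 ∸ 2 * i))
                                            (λ i → cong (b ^_) (trans (cong (r ∸_) (*-suc 2 i)) (sym (∸-+-assoc r 2 (2 * i))))))
                              (length-span y (r ∸ 2))))

  /1≡5*/5 : ∀ M → (ℤ.+ M) ℚ./ 1 ≡ (ℤ.+ 5 ℤ.* ℤ.+ M) ℚ./ 5
  /1≡5*/5 M = fromℚᵘ-cong {mkℚᵘ (ℤ.+ M) 0} {mkℚᵘ (ℤ.+ 5 ℤ.* ℤ.+ M) 4} (*≡* (cross (ℤ.+ M)))
    where
    cross : ∀ x → x ℤ.* ℤ.+ 5 ≡ (ℤ.+ 5 ℤ.* x) ℤ.* ℤ.+ 1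
    cross = ℤ-Solver.solve-∀

  quotient-4 : ∀ q c → c < 4 → (4 * q + c) / 4 ≡ q
  quotient-4 q c c<4 = begin
    (4 * q + c) / 4   ≡⟨ cong (_/ 4) (trans (+-comm (4 * q) c) (cong (c +_) (*-comm 4 q))) ⟩
    (c + q * 4) / 4   ≡⟨ +-distrib-/ c (q * 4) small ⟩
    c / 4 + q * 4 / 4 ≡⟨ cong₂ _+_ (m<n⇒m/n≡0 c<4) (m*n/n≡m q 4) ⟩
    q                 ∎
    where
    open ≡-Reasoning
    small : c % 4 + q * 4 % 4 < 4
    small = subst (_< 4) (sym (trans (cong₂ _+_ (m<n⇒m%n≡m c<4) (m*n%n≡0 q 4)) (+-identityʳ c))) c<4

  parity-mod4 : ∀ q ρ → (4 * q + ρ) % 2 ≡ ρ % 2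
  parity-mod4 q ρ = trans (cong (_% 2) (regroup q ρ)) ([m+kn]%n≡m%n ρ (2 * q) 2)
    where
    regroup : ∀ q ρ → 4 * q + ρ ≡ ρ + 2 * q * 2
    regroup = ℕ-Solver.solve-∀

  data Mod4 (r : ℕ) : Set where
    ≡0 : ∀ q → r ≡ 4 * q + 0 → Mod4 r
    ≡1 : ∀ q → r ≡ 4 * q + 1 → Mod4 r
    ≡2 : ∀ q → r ≡ 4 * q + 2 → Mod4 r
    ≡3 : ∀ q → r ≡ 4 * q + 3 → Mod4 r

  div-mod-4 : ∀ r → r ≡ 4 * (r / 4) + r % 4
  div-mod-4 r = trans (m≡m%n+[m/n]*n r 4) (trans (+-comm (r % 4) _) (cong (_+ r % 4) (*-comm (r / 4) 4)))

  remainder-4 : ∀ q ρ → (4 * q + ρ) % 4 ≡ ρ % 4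
  remainder-4 q ρ = trans (cong (_% 4) (trans (+-comm (4 * q) ρ) (cong (ρ +_) (*-comm 4 q)))) ([m+kn]%n≡m%n ρ q 4)

  mod4 : ∀ r → Mod4 r
  mod4 r = by-remainder (r % 4) (m%n<n r 4) (div-mod-4 r)
    where
    by-remainder : ∀ ρ → ρ < 4 → r ≡ 4 * (r / 4) + ρ → Mod4 r
    by-remainder 0 _ = ≡0 (r / 4)
    by-remainder 1 _ = ≡1 (r / 4)
    by-remainder 2 _ = ≡2 (r / 4)
    by-remainder 3 _ = ≡3 (r / 4)
    by-remainder (suc (suc (suc (suc _)))) (s≤s (s≤s (s≤s (s≤s ()))))

  ⊓-≤-left : ∀ {u y i} → u ⊓ y ≤ i → i < y → u ≤ i
  ⊓-≤-left {u} {y} u⊓y≤i i<y with ≤-total u y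
  ... | inj₁ u≤y = subst (_≤ _) (m≤n⇒m⊓n≡m u≤y) u⊓y≤i
  ... | inj₂ y≤u = ⊥-elim (<-irrefl refl (≤-<-trans (subst (_≤ _) (m≥n⇒m⊓n≡n y≤u) u⊓y≤i) i<y))

  module Assembly (c k r y : ℕ) (2y<r : 2 * y < r) (r+1<k : r + 1 < k) where

    open WordCounts c
    open WordValues c
    open Values b

    a′ : ℕ
    a′ = k ∸ (2 + r)

    open Signs a′

    k≡ : suc a′ + suc r ≡ k
    k≡ = trans (regroup a′ r) (m+[n∸m]≡n (subst (_≤ k) (cong suc (+-comm r 1)) r+1<k))
      where
      regroup : ∀ a r → suc a + suc r ≡ 2 + r + a
      regroup = ℕ-Solver.solve-∀

    k-r≡a : ℤ.+ k ℤ.- ℤ.+ r ≡ ℤ.+ a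
    k-r≡a = trans (cong (λ k → ℤ.+ k ℤ.- ℤ.+ r) (sym k≡)) (cancel (ℤ.+ a′) (ℤ.+ r))
      where
      cancel : ∀ a r → (ℤ.+ 1 ℤ.+ a ℤ.+ (ℤ.+ 1 ℤ.+ r)) ℤ.- r ≡ ℤ.+ 2 ℤ.+ a
      cancel = ℤ-Solver.solve-∀

    k∸2≡a′+r : k ∸ 2 ≡ a′ + r
    k∸2≡a′+r = trans (cong (_∸ 2) (sym k≡)) (cong (λ z → suc z ∸ 2) (+-suc a′ r))

    interval≡ : interval b k r y ≡ applyUpTo (λ j → b ^ k + suc j) (span r y)
    interval≡ = trans (cong (λ n → map (λ j → b ^ k + suc j) (upTo n)) (length-span y r))
                      (map-applyUpTo (λ j → b ^ k + suc j) (λ j → j) (span r y))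

    s-on-span : ∀ j → j < span r y → s b (b ^ k + suc j) ≡ pairCount (suc r) (a , 1) j
    s-on-span j j<span = subst (λ k → s b (b ^ k + suc j) ≡ pairCount (suc r) (a , 1) j) k≡
      (s-on-interval (suc a′) r j (<-≤-trans (<-trans j<span (span< r y (<⇒≤ 2y<r))) (b^n+b^n≤b^suc r)))

    γ≡ : ∀ x → 2 * x ≤ r → γ b k r x ≡ b ^ k + peakAt r x
    γ≡ x 2x≤r = begin
      value b (w k r x)                 ≡⟨ cong (value b) (w≡ k r x) ⟩
      value b (1 ∷ zeros ++ u)          ≡⟨ value-∷ 1 (zeros ++ u) ⟩
      1 * b ^ length (zeros ++ u) + value b (zeros ++ u)
        ≡⟨ cong₂ _+_ (trans (*-identityˡ _) (cong (b ^_) total-length))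
                     (trans (value-++ zeros u) (cong (λ z → z * b ^ length u + value b u) (value-zeros (k ∸ r ∸ 1)))) ⟩
      b ^ k + value b u                 ≡⟨ cong (b ^ k +_) (value-rep10-++ x r v 2x≤r length-v value-v) ⟩
      b ^ k + peakAt r x                ∎
      where
      open ≡-Reasoning
      zeros v u : List ℕ
      zeros = replicate (k ∸ r ∸ 1) 0
      v = 0 ∷ rep10 (r / 2 ∸ x) ++ oddTail (r % 2)
      u = rep10 x ++ v
      tail-length : 2 * (r / 2 ∸ x) + length (oddTail (r % 2)) ≡ r ∸ 2 * x
      tail-length = begin
        2 * (r / 2 ∸ x) + length (oddTail (r % 2)) ≡⟨ cong₂ _+_ (*-distribˡ-∸ 2 (r / 2) x) (length-oddTail (r % 2) (m%n<n r 2)) ⟩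
        2 * (r / 2) ∸ 2 * x + r % 2               ≡⟨ +-∸-comm (r % 2) (*-monoʳ-≤ 2 x≤r/2) ⟨
        2 * (r / 2) + r % 2 ∸ 2 * x               ≡⟨ cong (_∸ 2 * x) r≡ ⟨
        r ∸ 2 * x                                 ∎
        where
        x≤r/2 : x ≤ r / 2
        x≤r/2 = subst (_≤ r / 2) (m*n/n≡m x 2) (/-monoˡ-≤ 2 (subst (_≤ r) (*-comm 2 x) 2x≤r))
        r≡ : r ≡ 2 * (r / 2) + r % 2
        r≡ = trans (m≡m%n+[m/n]*n r 2) (trans (+-comm (r % 2) _) (cong (_+ r % 2) (*-comm (r / 2) 2)))
      length-v : length v ≡ suc (r ∸ 2 * x)
      length-v = cong suc (trans (length-++ (rep10 (r / 2 ∸ x)))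
                                 (trans (cong (_+ length (oddTail (r % 2))) (length-rep10 (r / 2 ∸ x))) tail-length))
      value-v : value b v ≡ descPeak (r ∸ 2 * x)
      value-v = trans (value-alternating (r / 2 ∸ x) (r % 2)) (cong descPeak tail-length)
      total-length : length (zeros ++ u) ≡ k
      total-length = begin
        length (zeros ++ u)                         ≡⟨ length-++ zeros ⟩
        length zeros + length u                     ≡⟨ cong₂ _+_ (length-replicate (k ∸ r ∸ 1))
                                                             (trans (length-++ (rep10 x)) (cong₂ _+_ (length-rep10 x) length-v)) ⟩
        k ∸ r ∸ 1 + (2 * x + suc (r ∸ 2 * x))       ≡⟨ cong (k ∸ r ∸ 1 +_) (trans (+-suc (2 * x) _) (cong suc (m+[n∸m]≡n 2x≤r))) ⟩
        k ∸ r ∸ 1 + suc r                           ≡⟨ cong (_+ suc r) (trans (∸-+-assoc k r 1) (cong (k ∸_) (+-comm r 1))) ⟩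
        k ∸ suc r + suc r                           ≡⟨ m∸n+n≡m (<⇒≤ (subst (_< k) (+-comm r 1) r+1<k)) ⟩
        k                                           ∎

    Result : ℕ → Set
    Result x = (ν b k r y ≡ γ b k r x + 1) × ((ℤ.+ μ b k r y) ℚ./ 1 ≡ V (ℤ.+ k) (ℤ.+ r) (ℤ.+ x))

    result-at-peak : ∀ x → x ≤ y → (∀ i → i < x → G r i < G r x) → (∀ i → i ≤ y → G r i ≤ G r x) → Result x
    result-at-peak x x≤y rising top = ν≡ , μ≡
      where
      M P : ℕ
      M = G r x
      P = peakAt r x
      f : ℕ → ℕ
      f j = b ^ k + suc j
      2x<r : 2 * x < r
      2x<r = ≤-<-trans (*-monoʳ-≤ 2 x≤y) 2y<r
      attains : AttainsFirst (suc r) (a , 1) M P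
      attains = attainsFirst-peakAt x r (s≤s z≤n) ≤-refl 2x<r rising
      P<span : P < span r y
      P<span = peakAt<span r x≤y (<⇒≤ 2y<r)
      hit : s b (f P) ≡ M
      hit = trans (s-on-span P P<span) (proj₁ attains)
      values≡ : map (s b) (interval b k r y) ≡ applyUpTo (s b ∘ f) (span r y)
      values≡ = trans (cong (map (s b)) interval≡) (map-applyUpTo (s b) f (span r y))
      μ≡M : μ b k r y ≡ M
      μ≡M = trans (cong (foldr _⊔_ 0) values≡) (≤-antisym
        (max-≤ (span r y) (s b ∘ f) λ j j<span →
           subst (_≤ M) (sym (s-on-span j j<span)) (ev≤-on-span y r (a , 1) 2y<r top j j<span))
        (subst (_≤ foldr _⊔_ 0 (applyUpTo (s b ∘ f) (span r y))) hit (≤-max (span r y) (s b ∘ f) P P<span)))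
      ν≡ : ν b k r y ≡ γ b k r x + 1
      ν≡ = begin
        firstWith b (μ b k r y) (interval b k r y)  ≡⟨ cong₂ (firstWith b) μ≡M interval≡ ⟩
        firstWith b M (applyUpTo f (span r y))     ≡⟨ firstWith-applyUpTo b (span r y) f P P<span hit
                                                        (λ j j<P → subst (_< M) (sym (s-on-span j (<-trans j<P P<span))) (proj₂ attains j j<P)) ⟩
        b ^ k + suc P                              ≡⟨ +-suc (b ^ k) P ⟩
        suc (b ^ k + P)                            ≡⟨ +-comm 1 (b ^ k + P) ⟩
        b ^ k + P + 1                              ≡⟨ cong (_+ 1) (γ≡ x (<⇒≤ 2x<r)) ⟨
        γ b k r x + 1                              ∎
        where open ≡-Reasoning
      μ≡ : (ℤ.+ μ b k r y) ℚ./ 1 ≡ V (ℤ.+ k) (ℤ.+ r) (ℤ.+ x)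
      μ≡ = trans (cong (λ z → (ℤ.+ z) ℚ./ 1) μ≡M)
                 (trans (/1≡5*/5 M) (cong (ℚ._/ 5) (sym (numerator≡5*branchBound a k r x k-r≡a 2x<r))))

    result-unimodal : ∀ x → x ≤ y → (∀ i → i < x → G r i < G r (suc i)) →
                      (∀ i → x ≤ i → i < y → G r (suc i) ≤ G r i) → Result x
    result-unimodal x x≤y ascending descending with unimodal-peak (G r) x y ascending descending
    ... | rising , top = result-at-peak x x≤y rising top

    2i+2<r : ∀ {i} → i < y → 2 * suc i < r
    2i+2<r i<y = ≤-<-trans (*-monoʳ-≤ 2 i<y) 2y<r

    even-case : r % 2 ≡ 0 → Result y
    even-case r%2≡0 with mod4 r
    ... | ≡0 q r≡ = result-unimodal y ≤-refl (λ i i<y → ascent-≡0 {q = q} r≡ i (2i+2<r i<y)) (λ i y≤i i<y → contradiction y≤i (<⇒≱ i<y))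
    ... | ≡2 q r≡ = result-unimodal y ≤-refl (λ i i<y → ascent-≡2 {q = q} r≡ i (2i+2<r i<y)) (λ i y≤i i<y → contradiction y≤i (<⇒≱ i<y))
    ... | ≡1 q r≡ = contradiction (trans (sym (trans (cong (_% 2) r≡) (parity-mod4 q 1))) r%2≡0) λ ()
    ... | ≡3 q r≡ = contradiction (trans (sym (trans (cong (_% 2) r≡) (parity-mod4 q 3))) r%2≡0) λ ()

    -- For a = 2 the branches at q and q + 1 tie, and the first maximum is at q.
    exceptional-case : k ∸ 2 ≡ r → r % 4 ≡ 3 → r + 1 ≤ 4 * y → Result ((r ∸ 3) / 4)
    exceptional-case k∸2≡r r%4≡3 r+1≤4y = subst Result (sym x≡q) (result-unimodal q (<⇒≤ q<y) ascending descending)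
      where
      q : ℕ
      q = r / 4
      r≡ : r ≡ 4 * q + 3
      r≡ = trans (div-mod-4 r) (cong (4 * q +_) r%4≡3)
      x≡q : (r ∸ 3) / 4 ≡ q
      x≡q = trans (cong (λ z → (z ∸ 3) / 4) r≡)
                  (trans (cong (_/ 4) (trans (m+n∸n≡m (4 * q) 3) (sym (+-identityʳ (4 * q))))) (quotient-4 q 0 z<s))
      q<y : q < y
      q<y = *-cancelˡ-≤ 4 (subst (_≤ 4 * y) (trans (cong (_+ 1) r≡) (regroup q)) r+1≤4y)
        where
        regroup : ∀ q → 4 * q + 3 + 1 ≡ 4 * suc q
        regroup = ℕ-Solver.solve-∀
      a′≡0 : a′ ≡ 0
      a′≡0 = +-cancelʳ-≡ r a′ 0 (trans (sym k∸2≡a′+r) k∸2≡r)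
      ascending : ∀ i → i < q → G r i < G r (suc i)
      ascending i i<q = ascent-before {q = q} i i<q r≡ (2i+2<r (<-trans i<q q<y))
      descending : ∀ i → q ≤ i → i < y → G r (suc i) ≤ G r i
      descending i q≤i i<y with m≤n⇒m<n∨m≡n q≤i
      ... | inj₂ refl = plateau-≡3-at-q {q = q} r≡ a′≡0 (2i+2<r i<y)
      ... | inj₁ q<i = <⇒≤ (descent-≡3 {q = q} r≡ i q<i (2i+2<r i<y))

    generic-case : ¬ (r % 2 ≡ 0) → ¬ ((k ∸ 2 ≡ r) × (r % 4 ≡ 3) × (r + 1 ≤ 4 * y)) → Result (δ r y)
    generic-case r-odd not-exceptional with mod4 r
    ... | ≡0 q r≡ = contradiction (trans (cong (_% 2) r≡) (parity-mod4 q 0)) r-odd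
    ... | ≡2 q r≡ = contradiction (trans (cong (_% 2) r≡) (parity-mod4 q 2)) r-odd
    ... | ≡1 q r≡ = subst Result (sym (cong (_⊓ y) ceiling≡q)) (result-unimodal (q ⊓ y) (m⊓n≤n q y) ascending descending)
      where
      ceiling≡q : (r ∸ 1 + 3) / 4 ≡ q
      ceiling≡q = trans (cong (λ z → (z ∸ 1 + 3) / 4) r≡) (trans (cong (λ z → (z + 3) / 4) (m+n∸n≡m (4 * q) 1)) (quotient-4 q 3 (s≤s (s≤s (s≤s (s≤s z≤n))))))
      ascending : ∀ i → i < q ⊓ y → G r i < G r (suc i)
      ascending i i< = ascent-before i (<-≤-trans i< (m⊓n≤m q y)) r≡ (2i+2<r (<-≤-trans i< (m⊓n≤n q y)))
      descending : ∀ i → q ⊓ y ≤ i → i < y → G r (suc i) ≤ G r i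
      descending i q⊓y≤i i<y = <⇒≤ (descent-≡1 {q = q} r≡ i (⊓-≤-left q⊓y≤i i<y) (2i+2<r i<y))
    ... | ≡3 q r≡ = subst Result (sym (cong (_⊓ y) ceiling≡q+1)) (result-unimodal (suc q ⊓ y) (m⊓n≤n (suc q) y) ascending descending)
      where
      ceiling≡q+1 : (r ∸ 1 + 3) / 4 ≡ suc q
      ceiling≡q+1 = trans (cong (λ z → (z ∸ 1 + 3) / 4) r≡) (trans (cong (_/ 4) (regroup q)) (quotient-4 (suc q) 1 (s≤s (s≤s z≤n))))
        where
        regroup : ∀ q → 4 * q + 3 ∸ 1 + 3 ≡ 4 * suc q + 1
        regroup q = trans (cong (λ z → z ∸ 1 + 3) (+-suc (4 * q) 2)) (shift q)
          where
          shift : ∀ q → 4 * q + 2 + 3 ≡ 4 * suc q + 1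
          shift = ℕ-Solver.solve-∀
      ascending : ∀ i → i < suc q ⊓ y → G r i < G r (suc i)
      ascending i i< with m≤n⇒m<n∨m≡n (≤-pred (<-≤-trans i< (m⊓n≤m (suc q) y)))
      ... | inj₁ i<q = ascent-before {q = q} i i<q r≡ (2i+2<r i<y)
        where i<y = <-≤-trans i< (m⊓n≤n (suc q) y)
      ... | inj₂ refl = ascent-≡3-at-q {q = q} r≡ 1≤a′ (2i+2<r i<y)
        where
        i<y : i < y
        i<y = <-≤-trans i< (m⊓n≤n (suc q) y)
        1≤a′ : 1 ≤ a′
        1≤a′ with a′ ≟ 0
        ... | yes a′≡0 = contradiction (trans k∸2≡a′+r (cong (_+ r) a′≡0) , trans (cong (_% 4) r≡) (remainder-4 i 3) ,
                                        subst (_≤ 4 * y) (sym (trans (cong (_+ 1) r≡) (regroup i))) (*-monoʳ-≤ 4 i<y)) not-exceptional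
          where
          regroup : ∀ q → 4 * q + 3 + 1 ≡ 4 * suc q
          regroup = ℕ-Solver.solve-∀
        ... | no a′≢0 = n≢0⇒n>0 a′≢0
      descending : ∀ i → suc q ⊓ y ≤ i → i < y → G r (suc i) ≤ G r i
      descending i q+1⊓y≤i i<y = <⇒≤ (descent-≡3 {q = q} r≡ i (⊓-≤-left q+1⊓y≤i i<y) (2i+2<r i<y))

open import Defs
open import Data.Nat using (ℕ; suc; _+_; _*_; _∸_; _≤_; _<_; _/_; _%_; s≤s; z≤n)
open import Data.Integer using (+_)
open import Data.Rational using (ℚ)
import Data.Rational
open import Data.Product using (_×_; _,_)
open import Relation.Binary.PropositionalEquality using (_≡_)
open import Relation.Nullary using (¬_)

theorem23 : (b : ℕ) → 2 ≤ b → (k r y : ℕ) → 2 * y < r → r + 1 < k →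
    ((r % 2 ≡ 0 →
        (ν b k r y ≡ γ b k r y + 1) × ((+ μ b k r y) Data.Rational./ 1 ≡ V (+ k) (+ r) (+ y)))
    × (k ∸ 2 ≡ r → r % 4 ≡ 3 → r + 1 ≤ 4 * y →
        (ν b k r y ≡ γ b k r ((r ∸ 3) / 4) + 1)
        × ((+ μ b k r y) Data.Rational./ 1 ≡ V (+ k) (+ r) (+ ((r ∸ 3) / 4))))
    × (¬ (r % 2 ≡ 0) → ¬ ((k ∸ 2 ≡ r) × (r % 4 ≡ 3) × (r + 1 ≤ 4 * y)) →
        (ν b k r y ≡ γ b k r (δ r y) + 1)
        × ((+ μ b k r y) Data.Rational./ 1 ≡ V (+ k) (+ r) (+ δ r y))))
theorem23 (suc (suc c)) (s≤s (s≤s z≤n)) k r y 2y<r r+1<k = even-case , exceptional-case , generic-case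
  where open Proof.Assembly c k r y 2y<r r+1<k
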